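{- Let $\lambda$ and $\mu$ be strict partitions with $\mu\subseteq\lambda$. Expand the skew Schur $Q$-function $Q_{\lambda/\mu}=\sum_\nu c_\nu p_\nu$ in power sums and assign to $p_\nu$ the degree $\ell(\nu)$. Then every $\nu$ with $c_\nu\ne 0$ satisfies $\ell(\nu)\ge \mathrm{srank}(\lambda/\mu)$.
   Context: Shifted diagrams: for strict $\lambda$, $S(\lambda)$ is the Young diagram of $\lambda$ with row $i$ shifted $i-1$ squares to the right (square $(i,j)$ with $i\le j\le \lambda_i+i-1$), and $S(\lambda/\mu)=S(\lambda)\setminus S(\mu)$. The $j$-th diagonal consists of the squares $(1,j),(2,j+1),(3,j+2),\dots$. A skew shifted diagram is a strip if it is rookwise connected and each diagonal contains at most one square; its height $h$ is the number of rows it occupies. A double strip is a union of two strips both starting on the diagonal of squares $(j,j)$; its depth is $\alpha+\beta$ if it has $\alpha$ diagonals of length two and its diagonals of length one occupy $\beta$ rows. A strip tableau of shape $\lambda/\mu$ and type $\pi=(\pi_1,\dots,\pi_k)$ is a chain $S(\mu)=S(\lambda^0)\subseteq\dots\subseteq S(\lambda^k)=S(\lambda)$ of shifted diagrams of strict partitions with $|\lambda^i/\lambda^{i-1}|=\pi_i$ and each $S(\lambda^i/\lambda^{i-1})$ a strip or a double strip. Its weight $wt(T)$ is the product of $(-1)^{h-1}$ over its strips of height $h$ and $2(-1)^{d-1}$ over its double strips of depth $d$. Then $Q_{\lambda/\mu}=\sum_{\pi}\sum_T 2^{\ell(\pi)}wt(T)\,p_\pi/z_\pi$, summed over partitions $\pi$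 of $|\lambda|-|\mu|$ into odd parts and strip tableaux $T$ of shape $\lambda/\mu$ and type $\pi$, where $z_\pi=\prod_i i^{m_i}m_i!$ if $\pi$ has $m_i$ parts equal to $i$. A skew bar tableau of shape $\lambda/\mu$ is a filling of $S(\lambda)$ by nonnegative integers such that: (1) rows weakly increase; (2) each occurring positive integer occurs an odd number of times; (3) each positive integer appears in at most two rows, and if in two rows, both rows begin with it; (4) for each $i$, the composition of row lengths after removing all squares with entries larger than $i$ has distinct parts; (5) the partition obtained by removing all squares filled with positive integers and reordering the remaining (nonempty) rows is $\mu$. Its number of bars is the number of distinct positive entries; $\mathrm{srank}(\lambda/\mu)$ is the minimum number of bars among skew bar tableaux of shape $\lambda/\mu$. -}

module Defs where

open import Data.Bool using (Bool; true; false; _∧_; _∨_; not; if_then_else_)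
open import Data.Nat using (ℕ; zero; suc; _+_; _*_; _∸_; _^_; _≤_; _<_; _≥_; _>_; _≡ᵇ_; _≤ᵇ_; _<ᵇ_; ∣_-_∣; _!; NonZero; _⊔_; _%_)
open import Data.Nat.Properties using (m*n≢0; m^n≢0; _!≢0)
open import Data.List using (List; []; _∷_; [_]; _++_; map; concat; concatMap; length; filterᵇ; deduplicateᵇ; upTo; foldr; head)
open import Data.Bool.ListAction using (all; any)
open import Data.Nat.ListAction using (sum)
open import Data.List.Relation.Unary.All using (All)
open import Data.List.Relation.Unary.Linked using (Linked)
open import Data.List.Relation.Unary.Unique.Propositional using (Unique)
open import Data.List.Relation.Binary.Permutation.Propositional using (_↭_)
open import Data.Maybe using (just)
open import Data.Product using (_×_; _,_; proj₁; proj₂)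
open import Data.Integer as ℤ using (ℤ; +_)
open import Data.Rational as ℚ using (ℚ)
open import Relation.Binary.PropositionalEquality using (_≡_)

IsPartition : List ℕ → Set
IsPartition ν = All (1 ≤_) ν × Linked _≥_ ν

IsStrictPartition : List ℕ → Set
IsStrictPartition ν = All (1 ≤_) ν × Linked _>_ ν

size : List ℕ → ℕ
size = sum

-- the i-th part (1-indexed), 0 beyond the length
part : List ℕ → ℕ → ℕ
part []       _             = 0
part (_ ∷ _)  zero          = 0
part (a ∷ _)  (suc zero)    = a
part (_ ∷ as) (suc (suc i)) = part as (suc i)

-- Shifted diagrams.  A cell is (row i , column j), 1-indexed.

Cell : Set
Cell = ℕ × ℕ

inS : List ℕ → Cell → Bool
inS la (i , j) = (1 ≤ᵇ i) ∧ ((i ≤ᵇ j) ∧ (j <ᵇ part la i + i))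

cellsFrom : ℕ → List ℕ → List Cell
cellsFrom i []       = []
cellsFrom i (a ∷ as) = map (λ k → (i , i + k)) (upTo a) ++ cellsFrom (suc i) as

cellsS : List ℕ → List Cell
cellsS = cellsFrom 1

skew : List ℕ → List ℕ → List Cell
skew la mu = filterᵇ (λ c → not (inS mu c)) (cellsS la)

subᵇ : List ℕ → List ℕ → Bool
subᵇ mu la = all (inS la) (cellsS mu)

eqℕsᵇ : List ℕ → List ℕ → Bool
eqℕsᵇ []       []       = true
eqℕsᵇ (a ∷ as) (b ∷ bs) = (a ≡ᵇ b) ∧ eqℕsᵇ as bs
eqℕsᵇ _        _        = false

diag : Cell → ℕ
diag (i , j) = j ∸ i

cellEq : Cell → Cell → Bool
cellEq (i , j) (k , l) = (i ≡ᵇ k) ∧ (j ≡ᵇ l)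

elemC : Cell → List Cell → Bool
elemC c = any (cellEq c)

countℕ : (ℕ → Bool) → List ℕ → ℕ
countℕ p xs = length (filterᵇ p xs)

distinctCount : List ℕ → ℕ
distinctCount xs = length (deduplicateᵇ _≡ᵇ_ xs)

adj : Cell → Cell → Bool
adj (i , j) (k , l) = ((i ≡ᵇ k) ∧ (∣ j - l ∣ ≡ᵇ 1)) ∨ ((j ≡ᵇ l) ∧ (∣ i - k ∣ ≡ᵇ 1))

step : List Cell → List Cell → List Cell
step cs r = filterᵇ (λ c → elemC c r ∨ any (adj c) r) cs

reach : ℕ → List Cell → List Cell → List Cell
reach zero    cs r = r
reach (suc n) cs r = reach n cs (step cs r)

-- rookwise connected (length-many closure steps suffice)
rookConnected : List Cell → Bool
rookConnected []       = true
rookConnected (c ∷ cs) = all (λ d → elemC d (reach (length (c ∷ cs)) (c ∷ cs) [ c ])) (c ∷ cs)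

diagCount : List Cell → ℕ → ℕ
diagCount cs d = countℕ (_≡ᵇ d) (map diag cs)

diagsAtMostOne : List Cell → Bool
diagsAtMostOne cs = all (λ c → diagCount cs (diag c) ≤ᵇ 1) cs

isStrip : List Cell → Bool
isStrip cs = rookConnected cs ∧ diagsAtMostOne cs

height : List Cell → ℕ
height cs = distinctCount (map proj₁ cs)

subsets : {A : Set} → List A → List (List A)
subsets []       = [ [] ]
subsets (x ∷ xs) = subsets xs ++ map (x ∷_) (subsets xs)

minus : List Cell → List Cell → List Cell
minus cs as = filterᵇ (λ c → not (elemC c as)) cs

startsOnMain : List Cell → Bool
startsOnMain = any (λ c → diag c ≡ᵇ 0)

isDoubleStrip : List Cell → Bool
isDoubleStrip cs =
  any (λ as → isStrip as ∧ isStrip (minus cs as) ∧ startsOnMain as ∧ startsOnMain (minus cs as))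
      (subsets cs)

depth : List Cell → ℕ
depth cs = distinctCount (filterᵇ (λ d → diagCount cs d ≡ᵇ 2) (map diag cs))
         + distinctCount (map proj₁ (filterᵇ (λ c → diagCount cs (diag c) ≡ᵇ 1) cs))

signPow : ℕ → ℤ
signPow zero    = + 1
signPow (suc k) = ℤ.- signPow k

stepWeight : List Cell → ℤ
stepWeight cs =
  if isStrip cs then signPow (height cs ∸ 1)
  else if isDoubleStrip cs then (+ 2) ℤ.* signPow (depth cs ∸ 1)
  else + 0

strictUpTo : ℕ → List (List ℕ)
strictUpTo zero    = [ [] ]
strictUpTo (suc n) = strictUpTo n ++ map (suc n ∷_) (strictUpTo n)

validStep : List ℕ → List ℕ → List ℕ → ℕ → Bool
validStep la prev κ p =
  subᵇ prev κ ∧ subᵇ κ la ∧ (size κ ≡ᵇ size prev + p)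
  ∧ (isStrip (skew κ prev) ∨ isDoubleStrip (skew κ prev))

-- strip tableaux of shape λ/prev and type π, each given as the list
-- of shapes (λ^1 , ... , λ^k) (with λ^0 = prev and λ^k = λ)
stripTableaux : List ℕ → List ℕ → List ℕ → List (List (List ℕ))
stripTableaux la prev []      = if eqℕsᵇ prev la then [ [] ] else []
stripTableaux la prev (p ∷ π) =
  concatMap (λ κ → map (κ ∷_) (stripTableaux la κ π))
            (filterᵇ (λ κ → validStep la prev κ p) (strictUpTo (part la 1)))

tableauWeight : List ℕ → List (List ℕ) → ℤ
tableauWeight prev []       = + 1
tableauWeight prev (κ ∷ ks) = stepWeight (skew κ prev) ℤ.* tableauWeight κ ks

sumℤ : List ℤ → ℤ
sumℤ = foldr ℤ._+_ (+ 0)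

weightSum : List ℕ → List ℕ → List ℕ → ℤ
weightSum la mu π = sumℤ (map (tableauWeight mu) (stripTableaux la mu π))

mult : ℕ → List ℕ → ℕ
mult i = countℕ (_≡ᵇ i)

zUpTo : List ℕ → ℕ → ℕ
zUpTo π zero    = 1
zUpTo π (suc k) = zUpTo π k * ((suc k) ^ mult (suc k) π * (mult (suc k) π) !)

zUpTo-nonZero : ∀ π k → NonZero (zUpTo π k)
zUpTo-nonZero π zero    = _
zUpTo-nonZero π (suc k) =
  m*n≢0 _ _ {{zUpTo-nonZero π k}}
        {{m*n≢0 _ _ {{m^n≢0 (suc k) (mult (suc k) π)}} {{(mult (suc k) π) !≢0}}}}

maxPart : List ℕ → ℕ
maxPart = foldr _⊔_ 0

z : List ℕ → ℕ
z π = zUpTo π (maxPart π)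

z-nonZero : ∀ π → NonZero (z π)
z-nonZero π = zUpTo-nonZero π (maxPart π)

allOdd : List ℕ → Bool
allOdd = all (λ n → n % 2 ≡ᵇ 1)

-- coefficient c_ν of p_ν in Q_{λ/μ} = Σ_π Σ_T 2^{ℓ(π)} wt(T) p_π / z_π
-- (zero unless ν has only odd parts)
coeffQ : List ℕ → List ℕ → List ℕ → ℚ
coeffQ la mu ν =
  if allOdd ν
  then ((+ (2 ^ length ν)) ℤ.* weightSum la mu ν) ℚ./ z ν
  else ℚ.0ℚ
  where instance _ = z-nonZero ν

-- Skew bar tableaux.  A filling of S(λ) is given by its rows (row i has λ_i entries).

count : ℕ → List ℕ → ℕ
count k = countℕ (_≡ᵇ k)

elemℕ : ℕ → List ℕ → Bool
elemℕ k = any (_≡ᵇ k)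

nonzero : List ℕ → List ℕ
nonzero = filterᵇ (1 ≤ᵇ_)

record IsSkewBarTableau (la mu : List ℕ) (B : List (List ℕ)) : Set where
  field
    shape     : map length B ≡ la
    rowsWeak  : All (Linked _≤_) B
    oddOcc    : ∀ k → 1 ≤ k → 1 ≤ count k (concat B) → count k (concat B) % 2 ≡ 1
    twoRows   : ∀ k → 1 ≤ k → length (filterᵇ (elemℕ k) B) ≤ 2
    twoRowsBegin : ∀ k → 1 ≤ k → length (filterᵇ (elemℕ k) B) ≡ 2 →
                   All (λ r → head r ≡ just k) (filterᵇ (elemℕ k) B)
    distinctParts : ∀ i → Unique (nonzero (map (λ r → countℕ (_≤ᵇ i) r) B))
    remainder : nonzero (map (count 0) B) ↭ mu

bars : List (List ℕ) → ℕ
bars B = distinctCount (nonzero (concat B))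

module Submission where

-- A nonzero coefficient of p_ν forces a strip tableau of type ν: a chain μ = λ⁰ ⊆ ⋯ ⊆ λᵏ = λ,
-- k = ℓ(ν), of strict partitions whose successive differences are strips or double strips.
-- Counting the added cells diagonal by diagonal shows that λⁱ arises from λⁱ⁻¹ either by
-- enlarging one part a to a + νᵢ (a = 0 allowed) or by adjoining two distinct parts with sum νᵢ.
-- Tracing each part of λ back through the chain and writing i into the cells of its row gained at
-- step i gives a skew bar tableau of shape λ/μ: the label i occupies νᵢ cells (an odd number) in at
-- most two rows, both starting with i in the double-strip case; the entries ≤ i fill the rows of λⁱ,
-- which have distinct lengths; and the zeros fill the rows of μ.  Its bars are among 1, …, k.

open import Defs

open import Data.Bool using (Bool; true; false; _∧_; _∨_; not; if_then_else_; T)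
open import Data.Bool.ListAction using (all; any)
open import Data.Bool.Properties using (T-≡; T-∧; T-∨)
open import Data.Empty using (⊥; ⊥-elim)
import Data.Integer as ℤ
import Data.Integer.Properties as ℤ
open import Data.List using (List; []; _∷_; [_]; _++_; map; concat; length; filterᵇ; upTo; replicate; head; deduplicateᵇ)
open import Data.List.Extrema.Nat using (min; max; argmin-sel; argmax-sel; min≤⊤; min≤xs; ⊥≤max; xs≤max)
open import Data.List.Membership.Propositional using (_∈_; _∉_; find)
open import Data.List.Membership.Propositional.Properties
  using (∈-∃++; ∈-upTo⁺; ∈-upTo⁻; ∈-filter⁻; ∈-map⁺; ∈-map⁻; ∈-++⁺ˡ; ∈-++⁺ʳ; ∈-++⁻; ∈-concat⁻′)
open import Data.List.Properties
  using (filter-accept; filter-reject; filter-++; filter-all; filter-none; length-++; length-replicate;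
         map-++; map-∘; map-id; map-cong)
open import Data.List.Relation.Binary.Permutation.Propositional using (_↭_; ↭-refl; ↭-prep; ↭-trans; ↭-sym)
open import Data.List.Relation.Binary.Permutation.Propositional.Properties using (shift)
open import Data.List.Relation.Unary.All as All using (All; []; _∷_)
open import Data.List.Relation.Unary.All.Properties using (all⁺; ++⁺; replicate⁺; map⁺)
import Data.List.Relation.Unary.AllPairs as AllPairs
open import Data.List.Relation.Unary.Any using (here; there)
open import Data.List.Relation.Unary.Any.Properties using (any⁻; deduplicate⁻)
import Data.List.Relation.Unary.Linked as Linked
open Linked using (Linked)
open import Data.List.Relation.Unary.Linked.Properties using (Linked⇒AllPairs)
open import Data.List.Relation.Unary.Unique.Propositional using (Unique; []; _∷_)
import Data.List.Relation.Unary.Unique.Propositional.Properties as Unique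
open import Data.Maybe using (just)
open import Data.Nat
open import Data.Nat.ListAction using (sum)
open import Data.Nat.ListAction.Properties using (sum-↭)
open import Data.Nat.Properties
open import Data.List.Membership.DecPropositional _≟_ using (_∈?_)
open import Data.Product using (_×_; _,_; proj₁; proj₂; Σ; ∃; swap)
open import Data.Rational as ℚ using (0ℚ)
import Data.Rational.Properties as ℚ
open import Data.Sum using (_⊎_; inj₁; inj₂; [_,_]′)
open import Data.Unit using (⊤; tt)
open import Function using (_∘_; Equivalence)
open import Relation.Binary.Definitions using (tri<; tri≈; tri>)
open import Relation.Binary.PropositionalEquality hiding ([_])
open import Relation.Nullary using (¬_; yes; no)
open import Relation.Nullary.Decidable using (T?)
open import Algebra.Properties.CommutativeSemigroup +-commutativeSemigroup
  using (interchange; x∙yz≈y∙xz; x∙yz≈xz∙y; x∙yz≈yx∙z)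

T⇒≡true : ∀ {b} → T b → b ≡ true
T⇒≡true = Equivalence.to T-≡

≡true⇒T : ∀ {b} → b ≡ true → T b
≡true⇒T = Equivalence.from T-≡

≡ᵇ-refl : ∀ n → (n ≡ᵇ n) ≡ true
≡ᵇ-refl n = T⇒≡true (≡⇒≡ᵇ n n refl)

≢⇒≡ᵇ≡false : ∀ {m n} → m ≢ n → (m ≡ᵇ n) ≡ false
≢⇒≡ᵇ≡false {m} {n} m≢n with m ≡ᵇ n in eq
... | false = refl
... | true  = ⊥-elim (m≢n (≡ᵇ⇒≡ m n (≡true⇒T eq)))

<⇒<ᵇ≡true : ∀ {m n} → m < n → (m <ᵇ n) ≡ true
<⇒<ᵇ≡true = T⇒≡true ∘ <⇒<ᵇ

≤⇒<ᵇ≡false : ∀ {m n} → n ≤ m → (m <ᵇ n) ≡ false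
≤⇒<ᵇ≡false {m} {n} n≤m with m <ᵇ n in eq
... | false = refl
... | true  = ⊥-elim (<⇒≱ (<ᵇ⇒< m n (≡true⇒T eq)) n≤m)

≤⇒≤ᵇ≡true : ∀ {m n} → m ≤ n → (m ≤ᵇ n) ≡ true
≤⇒≤ᵇ≡true = T⇒≡true ∘ ≤⇒≤ᵇ

<⇒≤ᵇ≡false : ∀ {m n} → n < m → (m ≤ᵇ n) ≡ false
<⇒≤ᵇ≡false {m} {n} n<m with m ≤ᵇ n in eq
... | false = refl
... | true  = ⊥-elim (<⇒≱ n<m (≤ᵇ⇒≤ m n (≡true⇒T eq)))

indicator : Bool → ℕ
indicator b = if b then 1 else 0

all-lookup : ∀ {A : Set} (q : A → Bool) {xs x} → T (all q xs) → x ∈ xs → T (q x)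
all-lookup q {xs} t = All.lookup (all⁺ q xs t)

any-find : ∀ {A : Set} (q : A → Bool) xs → T (any q xs) → ∃ λ x → x ∈ xs × T (q x)
any-find q xs t = find (any⁻ q xs t)

module _ {A : Set} (p : A → Bool) where

  filterᵇ-accept : ∀ x xs → p x ≡ true → filterᵇ p (x ∷ xs) ≡ x ∷ filterᵇ p xs
  filterᵇ-accept x xs e = filter-accept (T? ∘ p) (≡true⇒T e)

  filterᵇ-reject : ∀ x xs → p x ≡ false → filterᵇ p (x ∷ xs) ≡ filterᵇ p xs
  filterᵇ-reject x xs e = filter-reject (T? ∘ p) (λ t → subst T e t)

countℕ-∷ : ∀ (p : ℕ → Bool) x xs → countℕ p (x ∷ xs) ≡ indicator (p x) + countℕ p xs
countℕ-∷ p x xs with p x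
... | true  = refl
... | false = refl

countℕ-++ : ∀ (p : ℕ → Bool) xs ys → countℕ p (xs ++ ys) ≡ countℕ p xs + countℕ p ys
countℕ-++ p xs ys = trans (cong length (filter-++ (T? ∘ p) xs ys)) (length-++ (filterᵇ p xs))

count-++ : ∀ k xs ys → count k (xs ++ ys) ≡ count k xs + count k ys
count-++ k = countℕ-++ (_≡ᵇ k)

count-here : ∀ k xs → count k (k ∷ xs) ≡ suc (count k xs)
count-here k xs = cong length (filterᵇ-accept (_≡ᵇ k) k xs (≡ᵇ-refl k))

count-there : ∀ {k x} xs → x ≢ k → count k (x ∷ xs) ≡ count k xs
count-there {k} {x} xs x≢k = cong length (filterᵇ-reject (_≡ᵇ k) x xs (≢⇒≡ᵇ≡false x≢k))

count>0⇒∈ : ∀ k xs → 1 ≤ count k xs → k ∈ xs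
count>0⇒∈ k (x ∷ xs) c with x ≟ k
... | yes refl = here refl
... | no  x≢k  = there (count>0⇒∈ k xs (subst (1 ≤_) (count-there xs x≢k) c))

∈⇒count>0 : ∀ {k xs} → k ∈ xs → 1 ≤ count k xs
∈⇒count>0 {k} {x ∷ xs} k∈ with x ≟ k | k∈
... | yes refl | _         = subst (1 ≤_) (sym (count-here k xs)) (s≤s z≤n)
... | no  x≢k  | here refl = ⊥-elim (x≢k refl)
... | no  x≢k  | there k∈' = subst (1 ≤_) (sym (count-there xs x≢k)) (∈⇒count>0 k∈')

∉⇒count≡0 : ∀ {k xs} → k ∉ xs → count k xs ≡ 0
∉⇒count≡0 {k} {xs} k∉ with count k xs in eq
... | zero  = refl
... | suc _ = ⊥-elim (k∉ (count>0⇒∈ k xs (subst (1 ≤_) (sym eq) (s≤s z≤n))))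

count⇒↭ : ∀ xs ys → (∀ k → count k xs ≡ count k ys) → xs ↭ ys
count⇒↭ []       []       _ = ↭-refl
count⇒↭ []       (y ∷ ys) h = ⊥-elim (1+n≢0 (trans (sym (count-here y ys)) (sym (h y))))
count⇒↭ (x ∷ xs) ys       h
  with ys₁ , ys₂ , refl ← ∈-∃++ (count>0⇒∈ x ys (subst (1 ≤_) (trans (sym (count-here x xs)) (h x)) (s≤s z≤n)))
  = ↭-trans (↭-prep x (count⇒↭ xs (ys₁ ++ ys₂) h′)) (↭-sym (shift x ys₁ ys₂))
  where
  h′ : ∀ k → count k xs ≡ count k (ys₁ ++ ys₂)
  h′ k with x ≟ k
  ... | yes refl = suc-injective (begin
    suc (count x xs)                  ≡⟨ sym (count-here x xs) ⟩
    count x (x ∷ xs)                  ≡⟨ h x ⟩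
    count x (ys₁ ++ x ∷ ys₂)          ≡⟨ count-++ x ys₁ (x ∷ ys₂) ⟩
    count x ys₁ + count x (x ∷ ys₂)   ≡⟨ cong (count x ys₁ +_) (count-here x ys₂) ⟩
    count x ys₁ + suc (count x ys₂)   ≡⟨ +-suc _ _ ⟩
    suc (count x ys₁ + count x ys₂)   ≡⟨ cong suc (count-++ x ys₁ ys₂) ⟨
    suc (count x (ys₁ ++ ys₂))        ∎)
    where open ≡-Reasoning
  ... | no x≢k = begin
    count k xs                        ≡⟨ count-there xs x≢k ⟨
    count k (x ∷ xs)                  ≡⟨ h k ⟩
    count k (ys₁ ++ x ∷ ys₂)          ≡⟨ count-++ k ys₁ (x ∷ ys₂) ⟩
    count k ys₁ + count k (x ∷ ys₂)   ≡⟨ cong (count k ys₁ +_) (count-there ys₂ x≢k) ⟩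
    count k ys₁ + count k ys₂         ≡⟨ count-++ k ys₁ ys₂ ⟨
    count k (ys₁ ++ ys₂)              ∎
    where open ≡-Reasoning

Unique⇒count≤1 : ∀ {xs} → Unique xs → ∀ k → count k xs ≤ 1
Unique⇒count≤1 []                   k = z≤n
Unique⇒count≤1 {x ∷ xs} (x∉ ∷ uxs) k with x ≟ k
... | yes refl = subst (_≤ 1) (sym (count-here x xs))
                   (s≤s (≤-reflexive (∉⇒count≡0 (λ x∈ → All.lookup x∉ x∈ refl))))
... | no x≢k   = subst (_≤ 1) (sym (count-there xs x≢k)) (Unique⇒count≤1 uxs k)

count≤1⇒Unique : ∀ xs → (∀ k → count k xs ≤ 1) → Unique xs
count≤1⇒Unique []       _ = []
count≤1⇒Unique (x ∷ xs) h = All.tabulate x∉xs ∷ count≤1⇒Unique xs h′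
  where
  x∉xs : ∀ {v} → v ∈ xs → x ≢ v
  x∉xs v∈ refl = 1+n≰n (≤-trans (s≤s (∈⇒count>0 v∈)) (subst (_≤ 1) (count-here x xs) (h x)))
  h′ : ∀ k → count k xs ≤ 1
  h′ k = ≤-trans (m≤n+m _ _) (subst (_≤ 1) (countℕ-∷ (_≡ᵇ k) x xs) (h k))

length≡countℕ+countℕ-not : ∀ (q : ℕ → Bool) xs → length xs ≡ countℕ q xs + countℕ (not ∘ q) xs
length≡countℕ+countℕ-not q []       = refl
length≡countℕ+countℕ-not q (x ∷ xs) with q x
... | true  = cong suc (length≡countℕ+countℕ-not q xs)
... | false = trans (cong suc (length≡countℕ+countℕ-not q xs)) (sym (+-suc _ _))

Unique-bounded⇒length≤ : ∀ L ys → Unique ys → All (λ y → 1 ≤ y × y ≤ L) ys → length ys ≤ L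
Unique-bounded⇒length≤ zero    []      _ _                 = z≤n
Unique-bounded⇒length≤ zero    (_ ∷ _) _ ((1≤y , y≤0) ∷ _) = ⊥-elim (1+n≰n (≤-trans 1≤y y≤0))
Unique-bounded⇒length≤ (suc L) ys      u bounds = begin
  length ys                          ≡⟨ length≡countℕ+countℕ-not (_≡ᵇ suc L) ys ⟩
  count (suc L) ys + length others   ≤⟨ +-mono-≤ (Unique⇒count≤1 u (suc L))
                                                 (Unique-bounded⇒length≤ L others (Unique.filter⁺ _ u) others-bounded) ⟩
  1 + L                              ∎
  where
  open ≤-Reasoning
  others = filterᵇ (not ∘ (_≡ᵇ suc L)) ys
  others-bounded : All (λ y → 1 ≤ y × y ≤ L) others
  others-bounded = All.tabulate λ y∈ → bounded (∈-filter⁻ (T? ∘ (not ∘ (_≡ᵇ suc L))) y∈)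
    where
    bounded : ∀ {y} → y ∈ ys × T (not (y ≡ᵇ suc L)) → 1 ≤ y × y ≤ L
    bounded {y} (y∈ , y≢) with All.lookup bounds y∈
    ... | 1≤y , y≤1+L = 1≤y , s≤s⁻¹ (≤∧≢⇒< y≤1+L λ { refl → subst (T ∘ not) (≡ᵇ-refl y) y≢ })

count-filterᵇ-kept : ∀ (q : ℕ → Bool) {d} xs → q d ≡ true → count d (filterᵇ q xs) ≡ count d xs
count-filterᵇ-kept q     []       _ = refl
count-filterᵇ-kept q {d} (x ∷ xs) e with x ≟ d
... | yes refl rewrite filterᵇ-accept q x xs e | count-here x (filterᵇ q xs) | count-here x xs
               = cong suc (count-filterᵇ-kept q xs e)
... | no x≢d with q x
...   | true  rewrite count-there (filterᵇ q xs) x≢d | count-there xs x≢d = count-filterᵇ-kept q xs e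
...   | false rewrite count-there xs x≢d = count-filterᵇ-kept q xs e

count-filterᵇ-dropped : ∀ (q : ℕ → Bool) {d} xs → q d ≡ false → count d (filterᵇ q xs) ≡ 0
count-filterᵇ-dropped q xs e =
  ∉⇒count≡0 {xs = filterᵇ q xs} λ d∈ → subst T e (proj₂ (∈-filter⁻ (T? ∘ q) {xs = xs} d∈))

count-upTo : ∀ d a → count d (upTo a) ≡ indicator (d <ᵇ a)
count-upTo d a with d <? a
... | yes d<a rewrite <⇒<ᵇ≡true d<a =
      ≤-antisym (Unique⇒count≤1 (Unique.upTo⁺ a) d) (∈⇒count>0 (∈-upTo⁺ d<a))
... | no d≮a  rewrite ≤⇒<ᵇ≡false (≮⇒≥ d≮a) = ∉⇒count≡0 (d≮a ∘ ∈-upTo⁻)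

strict⇒Unique : ∀ {xs} → Linked _>_ xs → Unique xs
strict⇒Unique = AllPairs.map (λ x>y → ≢-sym (<⇒≢ x>y)) ∘ Linked⇒AllPairs (λ x>y y>z → <-trans y>z x>y)

count-strict≤1 : ∀ {xs} → IsStrictPartition xs → ∀ k → count k xs ≤ 1
count-strict≤1 (_ , decreasing) = Unique⇒count≤1 (strict⇒Unique decreasing)

count0-positive : ∀ {xs} → All (1 ≤_) xs → count 0 xs ≡ 0
count0-positive pos = ∉⇒count≡0 λ 0∈ → 1+n≰n (All.lookup pos 0∈)

partsAbove : List ℕ → ℕ → ℕ
partsAbove la d = countℕ (d <ᵇ_) la

+-<ᵇ-cancelˡ : ∀ n m o → (n + m <ᵇ n + o) ≡ (m <ᵇ o)
+-<ᵇ-cancelˡ zero    m o = refl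
+-<ᵇ-cancelˡ (suc n) m o = +-<ᵇ-cancelˡ n m o

not-<ᵇ : ∀ m n → not (m <ᵇ n) ≡ (n ≤ᵇ m)
not-<ᵇ m       zero    = refl
not-<ᵇ zero    (suc n) = refl
not-<ᵇ (suc m) (suc zero)    = refl
not-<ᵇ (suc m) (suc (suc n)) = not-<ᵇ m (suc n)

rowCell : ℕ → ℕ → Cell
rowCell i k = (suc i , suc i + k)

notInS-rowCell : ∀ prev i k → not (inS prev (rowCell i k)) ≡ (part prev (suc i) ≤ᵇ k)
notInS-rowCell prev i k
  rewrite ≤⇒≤ᵇ≡true (m≤m+n (suc i) k) | +-comm (part prev (suc i)) (suc i)
        | +-<ᵇ-cancelˡ (suc i) k (part prev (suc i)) = not-<ᵇ k (part prev (suc i))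

newDiagonalsInRow : ∀ prev i xs →
  map diag (filterᵇ (not ∘ inS prev) (map (rowCell i) xs)) ≡ filterᵇ (part prev (suc i) ≤ᵇ_) xs
newDiagonalsInRow prev i []       = refl
newDiagonalsInRow prev i (x ∷ xs) with part prev (suc i) ≤ᵇ x in e
... | true  rewrite filterᵇ-accept (not ∘ inS prev) (rowCell i x) (map (rowCell i) xs) (trans (notInS-rowCell prev i x) e)
  = cong₂ _∷_ (m+n∸m≡n (suc i) x) (newDiagonalsInRow prev i xs)
... | false rewrite filterᵇ-reject (not ∘ inS prev) (rowCell i x) (map (rowCell i) xs) (trans (notInS-rowCell prev i x) e)
  = newDiagonalsInRow prev i xs

newDiagonalsFrom : List ℕ → ℕ → List ℕ → List ℕ
newDiagonalsFrom prev i κ = map diag (filterᵇ (not ∘ inS prev) (cellsFrom (suc i) κ))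

newDiagonalsFrom-∷ : ∀ prev i a as →
  newDiagonalsFrom prev i (a ∷ as) ≡ filterᵇ (part prev (suc i) ≤ᵇ_) (upTo a) ++ newDiagonalsFrom prev (suc i) as
newDiagonalsFrom-∷ prev i a as
  rewrite filter-++ (T? ∘ (not ∘ inS prev)) (map (rowCell i) (upTo a)) (cellsFrom (suc (suc i)) as)
        | map-++ diag (filterᵇ (not ∘ inS prev) (map (rowCell i) (upTo a)))
                      (filterᵇ (not ∘ inS prev) (cellsFrom (suc (suc i)) as))
  = cong (_++ newDiagonalsFrom prev (suc i) as) (newDiagonalsInRow prev i (upTo a))

partsAboveInRows : List ℕ → ℕ → ℕ → ℕ → ℕ
partsAboveInRows prev i zero    d = 0
partsAboveInRows prev i (suc n) d = indicator (d <ᵇ part prev (suc i)) + partsAboveInRows prev (suc i) n d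

RowsFitFrom : List ℕ → ℕ → List ℕ → Set
RowsFitFrom prev i []       = ⊤
RowsFitFrom prev i (a ∷ as) = part prev (suc i) ≤ a × RowsFitFrom prev (suc i) as

indicator-<ᵇ-split : ∀ P a d → P ≤ a →
  indicator (d <ᵇ a) ≡ indicator (d <ᵇ P) + count d (filterᵇ (P ≤ᵇ_) (upTo a))
indicator-<ᵇ-split P a d P≤a with <-cmp d P
... | tri< d<P _ _ rewrite <⇒<ᵇ≡true d<P | <⇒<ᵇ≡true (<-≤-trans d<P P≤a)
                         | count-filterᵇ-dropped (P ≤ᵇ_) (upTo a) (<⇒≤ᵇ≡false d<P) = refl
... | tri≈ _ refl _ rewrite ≤⇒<ᵇ≡false (≤-refl {d}) | count-filterᵇ-kept (d ≤ᵇ_) (upTo a) (≤⇒≤ᵇ≡true (≤-refl {d}))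
                         | count-upTo d a = refl
... | tri> _ _ P<d rewrite ≤⇒<ᵇ≡false (<⇒≤ P<d) | count-filterᵇ-kept (P ≤ᵇ_) (upTo a) (≤⇒≤ᵇ≡true (<⇒≤ P<d))
                         | count-upTo d a = refl

partsAbove-rows : ∀ prev i as → RowsFitFrom prev i as → ∀ d →
  partsAbove as d ≡ partsAboveInRows prev i (length as) d + count d (newDiagonalsFrom prev i as)
partsAbove-rows prev i []       _          d = refl
partsAbove-rows prev i (a ∷ as) (P≤a , fit) d
  rewrite countℕ-∷ (d <ᵇ_) a as | newDiagonalsFrom-∷ prev i a as
        | count-++ d (filterᵇ (part prev (suc i) ≤ᵇ_) (upTo a)) (newDiagonalsFrom prev (suc i) as)
        | partsAbove-rows prev (suc i) as fit d | indicator-<ᵇ-split (part prev (suc i)) a d P≤a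
  = interchange (indicator (d <ᵇ part prev (suc i))) (count d (filterᵇ (part prev (suc i) ≤ᵇ_) (upTo a)))
                (partsAboveInRows prev (suc i) (length as) d) (count d (newDiagonalsFrom prev (suc i) as))

partsAboveInRows-shift : ∀ b bs i n d → partsAboveInRows (b ∷ bs) (suc i) n d ≡ partsAboveInRows bs i n d
partsAboveInRows-shift b bs i zero    d = refl
partsAboveInRows-shift b bs i (suc n) d = cong (indicator (d <ᵇ part bs (suc i)) +_) (partsAboveInRows-shift b bs (suc i) n d)

partsAboveInRows-[] : ∀ i n d → partsAboveInRows [] i n d ≡ 0
partsAboveInRows-[] i zero    d = refl
partsAboveInRows-[] i (suc n) d rewrite ≤⇒<ᵇ≡false {d} {0} z≤n = partsAboveInRows-[] (suc i) n d

partsAbove≡partsAboveInRows : ∀ prev n d → length prev ≤ n → partsAbove prev d ≡ partsAboveInRows prev 0 n d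
partsAbove≡partsAboveInRows []       n       d _ = sym (partsAboveInRows-[] 0 n d)
partsAbove≡partsAboveInRows (b ∷ bs) (suc n) d (s≤s len≤n)
  rewrite countℕ-∷ (d <ᵇ_) b bs | partsAboveInRows-shift b bs 0 n d
  = cong (indicator (d <ᵇ b) +_) (partsAbove≡partsAboveInRows bs n d len≤n)

rowCell∈cellsFrom : ∀ i as r k → k < part as (suc r) → rowCell (i + r) k ∈ cellsFrom (suc i) as
rowCell∈cellsFrom i (a ∷ as) zero    k k<a rewrite +-identityʳ i = ∈-++⁺ˡ (∈-map⁺ (rowCell i) (∈-upTo⁺ k<a))
rowCell∈cellsFrom i (a ∷ as) (suc r) k k<  rewrite +-suc i r =
  ∈-++⁺ʳ (map (rowCell i) (upTo a)) (rowCell∈cellsFrom (suc i) as r k k<)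

subᵇ⇒part≤ : ∀ prev κ → T (subᵇ prev κ) → ∀ r → part prev (suc r) ≤ part κ (suc r)
subᵇ⇒part≤ prev κ sub r with part prev (suc r) in eq
... | zero  = z≤n
... | suc b = +-cancelʳ-< (suc r) b (part κ (suc r)) (subst (_< part κ (suc r) + suc r) (+-comm (suc r) b) (<ᵇ⇒< _ _ inκ))
  where
  cell∈prev : rowCell r b ∈ cellsS prev
  cell∈prev = rowCell∈cellsFrom 0 prev r b (subst (b <_) (sym eq) ≤-refl)
  inκ : T (suc r + b <ᵇ part κ (suc r) + suc r)
  inκ = proj₂ (Equivalence.to (T-∧ {suc r ≤ᵇ suc r + b}) (all-lookup (inS κ) sub cell∈prev))

part≤⇒RowsFitFrom : ∀ prev i as → (∀ r → part prev (suc (i + r)) ≤ part as (suc r)) → RowsFitFrom prev i as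
part≤⇒RowsFitFrom prev i []       h = tt
part≤⇒RowsFitFrom prev i (a ∷ as) h =
  subst (λ x → part prev (suc x) ≤ a) (+-identityʳ i) (h 0) ,
  part≤⇒RowsFitFrom prev (suc i) as (λ r → subst (λ x → part prev (suc x) ≤ part as (suc r)) (+-suc i r) (h (suc r)))

part-positive : ∀ xs r → All (1 ≤_) xs → r < length xs → 1 ≤ part xs (suc r)
part-positive (x ∷ xs) zero    (p ∷ ps) _         = p
part-positive (x ∷ xs) (suc r) (p ∷ ps) (s≤s r<) = part-positive xs r ps r<

part-beyond : ∀ xs r → length xs ≤ r → part xs (suc r) ≡ 0
part-beyond []       r       _         = refl
part-beyond (x ∷ xs) (suc r) (s≤s len≤) = part-beyond xs r len≤

part≤⇒length≤ : ∀ prev κ → All (1 ≤_) prev → (∀ r → part prev (suc r) ≤ part κ (suc r)) →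
  length prev ≤ length κ
part≤⇒length≤ prev κ pos h with length prev ≤? length κ
... | yes le = le
... | no ¬le = ⊥-elim (1+n≰n (≤-trans (part-positive prev (length κ) pos (≰⇒> ¬le))
                                        (subst (part prev (suc (length κ)) ≤_) (part-beyond κ (length κ) ≤-refl) (h (length κ)))))

-- The cells of S(κ/prev) in row i lie on the diagonals prev_i, …, κ_i - 1.
partsAbove-skew : ∀ prev κ → All (1 ≤_) prev → T (subᵇ prev κ) → ∀ d →
  partsAbove κ d ≡ partsAbove prev d + diagCount (skew κ prev) d
partsAbove-skew prev κ pos sub d =
  trans (partsAbove-rows prev 0 κ (part≤⇒RowsFitFrom prev 0 κ part≤) d)
        (cong (_+ diagCount (skew κ prev) d)
              (sym (partsAbove≡partsAboveInRows prev (length κ) d (part≤⇒length≤ prev κ pos part≤))))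
  where
  part≤ = subᵇ⇒part≤ prev κ sub

-- The diagonals of a strip form an interval

Shifted : Cell → Set
Shifted (i , j) = i ≤ j

cellsFrom-Shifted : ∀ i as {c} → c ∈ cellsFrom i as → Shifted c
cellsFrom-Shifted i (a ∷ as) c∈ with ∈-++⁻ (map (λ k → (i , i + k)) (upTo a)) c∈
... | inj₂ c∈rest = cellsFrom-Shifted (suc i) as c∈rest
... | inj₁ c∈row with ∈-map⁻ (λ k → (i , i + k)) c∈row
...   | k , _ , refl = m≤m+n i k

skew-Shifted : ∀ κ prev {c} → c ∈ skew κ prev → Shifted c
skew-Shifted κ prev c∈ = cellsFrom-Shifted 1 κ (proj₁ (∈-filter⁻ (T? ∘ (not ∘ inS prev)) {xs = cellsS κ} c∈))

cellEq⇒≡ : ∀ c c′ → T (cellEq c c′) → c ≡ c′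
cellEq⇒≡ (i , j) (k , l) t with Equivalence.to T-∧ t
... | i≡k , j≡l = cong₂ _,_ (≡ᵇ⇒≡ i k i≡k) (≡ᵇ⇒≡ j l j≡l)

∣m-n∣≡1⇒ : ∀ m n → ∣ m - n ∣ ≡ 1 → n ≡ suc m ⊎ m ≡ suc n
∣m-n∣≡1⇒ zero    n       e = inj₁ e
∣m-n∣≡1⇒ (suc m) zero    e = inj₂ (cong suc (suc-injective e))
∣m-n∣≡1⇒ (suc m) (suc n) e with ∣m-n∣≡1⇒ m n e
... | inj₁ n≡1+m = inj₁ (cong suc n≡1+m)
... | inj₂ m≡1+n = inj₂ (cong suc m≡1+n)

NeighbouringDiagonals : Cell → Cell → Set
NeighbouringDiagonals c c′ = diag c ≡ suc (diag c′) ⊎ diag c′ ≡ suc (diag c)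

1+m∸n : ∀ {m n} → n ≤ m → suc m ∸ n ≡ suc (m ∸ n)
1+m∸n = +-∸-assoc 1

adj⇒NeighbouringDiagonals : ∀ c c′ → Shifted c → Shifted c′ → T (adj c c′) → NeighbouringDiagonals c c′
adj⇒NeighbouringDiagonals (i , j) (k , l) i≤j k≤l t with Equivalence.to T-∨ t
... | inj₁ sameRow with Equivalence.to T-∧ sameRow
...   | i≡k , d≡1 with ≡ᵇ⇒≡ i k i≡k | ∣m-n∣≡1⇒ j l (≡ᵇ⇒≡ _ 1 d≡1)
...     | refl | inj₁ refl = inj₂ (1+m∸n i≤j)
...     | refl | inj₂ refl = inj₁ (1+m∸n k≤l)
adj⇒NeighbouringDiagonals (i , j) (k , l) i≤j k≤l t | inj₂ sameColumn with Equivalence.to T-∧ sameColumn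
...   | j≡l , d≡1 with ≡ᵇ⇒≡ j l j≡l | ∣m-n∣≡1⇒ i k (≡ᵇ⇒≡ _ 1 d≡1)
...     | refl | inj₁ refl = inj₁ (1+m∸n k≤l)
...     | refl | inj₂ refl = inj₂ (1+m∸n i≤j)

module _ (L : List Cell) (Q : Cell → Set) (Q-back : ∀ {x y} → x ∈ L → T (adj x y) → Q y → Q x) where

  step-preserves : ∀ r → (∀ {y} → y ∈ r → Q y) → ∀ {x} → x ∈ step L r → Q x
  step-preserves r Qr {x} x∈ with ∈-filter⁻ (T? ∘ (λ c → elemC c r ∨ any (adj c) r)) {xs = L} x∈
  ... | x∈L , t with Equivalence.to T-∨ t
  ... | inj₁ x∈r = let y , y∈r , eq = any-find (cellEq x) r x∈r in subst Q (sym (cellEq⇒≡ x y eq)) (Qr y∈r)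
  ... | inj₂ x~r = let y , y∈r , x~y = any-find (adj x) r x~r in Q-back x∈L x~y (Qr y∈r)

  reach-preserves : ∀ n r → (∀ {y} → y ∈ r → Q y) → ∀ {x} → x ∈ reach n L r → Q x
  reach-preserves zero    r Qr = Qr
  reach-preserves (suc n) r Qr = reach-preserves n (step L r) (step-preserves r Qr)

rookConnected-induction : ∀ c cs (Q : Cell → Set) → T (rookConnected (c ∷ cs)) →
  (∀ {x y} → x ∈ c ∷ cs → T (adj x y) → Q y → Q x) → Q c → ∀ {d} → d ∈ c ∷ cs → Q d
rookConnected-induction c cs Q conn Q-back Qc {d} d∈
  with y , y∈ , eq ← any-find (cellEq d) _ (all-lookup (λ d → elemC d (reach (length (c ∷ cs)) (c ∷ cs) [ c ])) conn d∈)
  = subst Q (sym (cellEq⇒≡ d y eq))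
      (reach-preserves (c ∷ cs) Q Q-back (length (c ∷ cs)) [ c ] (λ { (here refl) → Qc }) y∈)

Convex : List ℕ → Set
Convex D = ∀ {x z t} → x ∈ D → z ∈ D → x < t → t < z → t ∈ D

-- A connected set of shifted cells missing the diagonal t lies entirely on one side of it.
rookConnected⇒Convex : ∀ L → (∀ {c} → c ∈ L → Shifted c) → T (rookConnected L) → Convex (map diag L)
rookConnected⇒Convex [] _ _ ()
rookConnected⇒Convex (c ∷ cs) shifted conn {t = t} x∈ z∈ x<t t<z with t ∈? map diag (c ∷ cs)
... | yes t∈ = t∈
... | no  t∉ with ∈-map⁻ diag {xs = c ∷ cs} x∈ | ∈-map⁻ diag {xs = c ∷ cs} z∈
... | c₁ , c₁∈ , refl | c₃ , c₃∈ , refl with <-cmp (diag c) t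
...   | tri< c<t _ _ = ⊥-elim (<-asym t<z (proj₂
          (rookConnected-induction c cs (λ x → Shifted x × diag x < t) conn below (shifted (here refl) , c<t) c₃∈)))
  where
  below : ∀ {x y} → x ∈ c ∷ cs → T (adj x y) → Shifted y × diag y < t → Shifted x × diag x < t
  below {x} {y} x∈ x~y (sy , y<t) with adj⇒NeighbouringDiagonals x y (shifted x∈) sy x~y
  ... | inj₁ dx = shifted x∈ ,
                  ≤∧≢⇒< (subst (_≤ t) (sym dx) y<t) (λ dx≡t → t∉ (subst (_∈ _) dx≡t (∈-map⁺ diag x∈)))
  ... | inj₂ dy = shifted x∈ , <-trans (subst (diag x <_) (sym dy) ≤-refl) y<t
...   | tri≈ _ c≡t _ = ⊥-elim (t∉ (here (sym c≡t)))
...   | tri> _ _ t<c = ⊥-elim (<-asym x<t (proj₂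
          (rookConnected-induction c cs (λ x → Shifted x × t < diag x) conn above (shifted (here refl) , t<c) c₁∈)))
  where
  above : ∀ {x y} → x ∈ c ∷ cs → T (adj x y) → Shifted y × t < diag y → Shifted x × t < diag x
  above {x} {y} x∈ x~y (sy , t<y) with adj⇒NeighbouringDiagonals x y (shifted x∈) sy x~y
  ... | inj₁ dx = shifted x∈ , <-trans t<y (subst (diag y <_) (sym dx) ≤-refl)
  ... | inj₂ dy = shifted x∈ ,
                  ≤∧≢⇒< (s≤s⁻¹ (subst (suc t ≤_) dy t<y)) (λ t≡dx → t∉ (subst (_∈ _) (sym t≡dx) (∈-map⁺ diag x∈)))

diagsAtMostOne⇒count≤1 : ∀ L → T (diagsAtMostOne L) → ∀ d → count d (map diag L) ≤ 1
diagsAtMostOne⇒count≤1 L atMostOne d with d ∈? map diag L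
... | no  d∉ = subst (_≤ 1) (sym (∉⇒count≡0 d∉)) z≤n
... | yes d∈ with ∈-map⁻ diag d∈
...   | c , c∈ , refl = ≤ᵇ⇒≤ _ 1 (all-lookup (λ c → diagCount L (diag c) ≤ᵇ 1) atMostOne c∈)

record Interval (D : List ℕ) (a b : ℕ) : Set where
  field
    a<b    : a < b
    inside : ∀ {d} → a ≤ d → d < b → count d D ≡ 1
    below  : ∀ {d} → d < a → count d D ≡ 0
    above  : ∀ {d} → b ≤ d → count d D ≡ 0

  top-edge : ∀ {y} → suc y ≡ b → count y D ≡ suc (count (suc y) D)
  top-edge refl = trans (inside (s≤s⁻¹ a<b) ≤-refl) (cong suc (sym (above ≤-refl)))

  bottom-edge : ∀ {y} → suc y ≡ a → count (suc y) D ≡ suc (count y D)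
  bottom-edge refl = trans (inside ≤-refl a<b) (cong suc (sym (below ≤-refl)))

  flat : ∀ {y} → suc y ≢ a → suc y ≢ b → count (suc y) D ≡ count y D
  flat {y} 1+y≢a 1+y≢b with <-cmp (suc y) a
  ... | tri< 1+y<a _ _ = trans (below 1+y<a) (sym (below (<-trans ≤-refl 1+y<a)))
  ... | tri≈ _ 1+y≡a _ = ⊥-elim (1+y≢a 1+y≡a)
  ... | tri> _ _ a<1+y with <-cmp (suc y) b
  ...   | tri< 1+y<b _ _ = trans (inside (<⇒≤ a<1+y) 1+y<b) (sym (inside (s≤s⁻¹ a<1+y) (<-trans ≤-refl 1+y<b)))
  ...   | tri≈ _ 1+y≡b _ = ⊥-elim (1+y≢b 1+y≡b)
  ...   | tri> _ _ b<1+y = trans (above (<⇒≤ b<1+y)) (sym (above (s≤s⁻¹ b<1+y)))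

min∈ : ∀ x xs → min x xs ∈ x ∷ xs
min∈ x xs with argmin-sel (λ y → y) x xs
... | inj₁ eq = here eq
... | inj₂ m  = there m

max∈ : ∀ x xs → max x xs ∈ x ∷ xs
max∈ x xs with argmax-sel (λ y → y) x xs
... | inj₁ eq = here eq
... | inj₂ m  = there m

min≤∈ : ∀ x xs {y} → y ∈ x ∷ xs → min x xs ≤ y
min≤∈ x xs (here refl) = min≤⊤ x xs
min≤∈ x xs (there y∈) = All.lookup (min≤xs x xs) y∈

∈≤max : ∀ x xs {y} → y ∈ x ∷ xs → y ≤ max x xs
∈≤max x xs (here refl) = ⊥≤max x xs
∈≤max x xs (there y∈) = All.lookup (xs≤max x xs) y∈

convex⇒Interval : ∀ x xs → (∀ d → count d (x ∷ xs) ≤ 1) → Convex (x ∷ xs) →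
  Interval (x ∷ xs) (min x xs) (suc (max x xs))
convex⇒Interval x xs atMostOne convex = record
  { a<b    = s≤s (min≤∈ x xs (max∈ x xs))
  ; inside = λ lo hi → ≤-antisym (atMostOne _) (∈⇒count>0 (between lo (s≤s⁻¹ hi)))
  ; below  = λ d<min → ∉⇒count≡0 (λ d∈ → <⇒≱ d<min (min≤∈ x xs d∈))
  ; above  = λ max<d → ∉⇒count≡0 (λ d∈ → <⇒≱ max<d (∈≤max x xs d∈))
  }
  where
  between : ∀ {d} → min x xs ≤ d → d ≤ max x xs → d ∈ x ∷ xs
  between lo hi with m≤n⇒m<n∨m≡n lo | m≤n⇒m<n∨m≡n hi
  ... | inj₂ refl | _         = min∈ x xs
  ... | _         | inj₂ refl = max∈ x xs
  ... | inj₁ lo<  | inj₁ <hi  = convex (min∈ x xs) (max∈ x xs) lo< <hi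

strip⇒Interval : ∀ c cs → (∀ {x} → x ∈ c ∷ cs → Shifted x) → T (isStrip (c ∷ cs)) →
  ∃ λ a → ∃ λ b → Interval (map diag (c ∷ cs)) a b
strip⇒Interval c cs shifted strip with Equivalence.to T-∧ strip
... | conn , atMostOne = _ , _ , convex⇒Interval (diag c) (map diag cs) (diagsAtMostOne⇒count≤1 (c ∷ cs) atMostOne)
                                   (rookConnected⇒Convex (c ∷ cs) shifted conn)

mainStrip⇒Interval : ∀ L → (∀ {c} → c ∈ L → Shifted c) → T (isStrip L) → T (startsOnMain L) →
  ∃ λ b → Interval (map diag L) 0 b
mainStrip⇒Interval (c ∷ cs) shifted strip main
  with x , x∈ , onMain ← any-find (λ c → diag c ≡ᵇ 0) (c ∷ cs) main
  with strip⇒Interval c cs shifted strip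
... | zero   , b , iv = b , iv
... | suc a′ , b , iv = ⊥-elim (1+n≰n (subst (1 ≤_) (Interval.below iv (s≤s z≤n))
                          (∈⇒count>0 (subst (_∈ map diag (c ∷ cs)) (≡ᵇ⇒≡ _ 0 onMain) (∈-map⁺ diag x∈)))))

-- How a strip or a double strip changes the parts

-- κ arises from prev by replacing one part a by b = a + p (a = 0: adding the part b),
-- or by adding two distinct parts b₁, b₂ with b₁ + b₂ = p.
data StripMove (prev κ : List ℕ) (p : ℕ) : Set where
  grow   : (a b : ℕ) → a < b → b ≡ a + p
         → count b κ ≡ 1 → count b prev ≡ 0
         → (1 ≤ a → count a κ ≡ 0 × count a prev ≡ 1)
         → (∀ x → 1 ≤ x → x ≢ a → x ≢ b → count x κ ≡ count x prev)
         → StripMove prev κ p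
  addTwo : (b₁ b₂ : ℕ) → 1 ≤ b₁ → 1 ≤ b₂ → b₁ ≢ b₂ → p ≡ b₁ + b₂
         → count b₁ κ ≡ 1 → count b₁ prev ≡ 0 → count b₂ κ ≡ 1 → count b₂ prev ≡ 0
         → (∀ x → 1 ≤ x → x ≢ b₁ → x ≢ b₂ → count x κ ≡ count x prev)
         → StripMove prev κ p

indicator-<ᵇ-suc : ∀ x y → indicator (x <ᵇ y) ≡ indicator (suc x <ᵇ y) + indicator (y ≡ᵇ suc x)
indicator-<ᵇ-suc x       zero          = refl
indicator-<ᵇ-suc zero    (suc zero)    = refl
indicator-<ᵇ-suc zero    (suc (suc y)) = refl
indicator-<ᵇ-suc (suc x) (suc zero)    = refl
indicator-<ᵇ-suc (suc x) (suc (suc y)) = indicator-<ᵇ-suc x (suc y)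

partsAbove-suc : ∀ la x → partsAbove la x ≡ partsAbove la (suc x) + count (suc x) la
partsAbove-suc []       x = refl
partsAbove-suc (y ∷ ys) x
  rewrite countℕ-∷ (x <ᵇ_) y ys | countℕ-∷ (suc x <ᵇ_) y ys | countℕ-∷ (_≡ᵇ suc x) y ys
        | partsAbove-suc ys x | indicator-<ᵇ-suc x y
  = interchange (indicator (suc x <ᵇ y)) (indicator (y ≡ᵇ suc x)) (partsAbove ys (suc x)) (count (suc x) ys)

≤1∧≡suc⇒ : ∀ {x z} → x ≤ 1 → x ≡ suc z → x ≡ 1 × z ≡ 0
≤1∧≡suc⇒ (s≤s z≤n) refl = refl , refl

-- N d counts the added cells on diagonal d; the multiplicity of each part changes by N (d - 1) - N d.
module Balance {prev κ : List ℕ} (sp : IsStrictPartition prev) (sκ : IsStrictPartition κ) (N : ℕ → ℕ)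
               (above : ∀ d → partsAbove κ d ≡ partsAbove prev d + N d) where

  balance : ∀ y → count (suc y) κ + N (suc y) ≡ count (suc y) prev + N y
  balance y = +-cancelˡ-≡ (partsAbove prev (suc y)) _ _ (begin
    partsAbove prev (suc y) + (count (suc y) κ + N (suc y))    ≡⟨ x∙yz≈xz∙y (partsAbove prev (suc y)) _ _ ⟩
    partsAbove prev (suc y) + N (suc y) + count (suc y) κ      ≡⟨ cong (_+ count (suc y) κ) (above (suc y)) ⟨
    partsAbove κ (suc y) + count (suc y) κ                     ≡⟨ partsAbove-suc κ y ⟨
    partsAbove κ y                                             ≡⟨ above y ⟩
    partsAbove prev y + N y                                    ≡⟨ cong (_+ N y) (partsAbove-suc prev y) ⟩
    partsAbove prev (suc y) + count (suc y) prev + N y         ≡⟨ +-assoc (partsAbove prev (suc y)) _ _ ⟩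
    partsAbove prev (suc y) + (count (suc y) prev + N y)       ∎)
    where open ≡-Reasoning

  raisedBy : ∀ {y} k → N y ≡ k + N (suc y) → count (suc y) κ ≡ k + count (suc y) prev
  raisedBy {y} k eq = +-cancelʳ-≡ (N (suc y)) _ _ (begin
    count (suc y) κ + N (suc y)              ≡⟨ balance y ⟩
    count (suc y) prev + N y                 ≡⟨ cong (count (suc y) prev +_) eq ⟩
    count (suc y) prev + (k + N (suc y))     ≡⟨ x∙yz≈yx∙z (count (suc y) prev) k _ ⟩
    k + count (suc y) prev + N (suc y)       ∎)
    where open ≡-Reasoning

  same : ∀ {y} → N (suc y) ≡ N y → count (suc y) κ ≡ count (suc y) prev
  same eq = raisedBy 0 (sym eq)

  gain : ∀ {y} → N y ≡ suc (N (suc y)) → count (suc y) κ ≡ 1 × count (suc y) prev ≡ 0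
  gain eq = ≤1∧≡suc⇒ (count-strict≤1 sκ _) (raisedBy 1 eq)

  noDoubleGain : ∀ {y} → N y ≡ 2 + N (suc y) → ⊥
  noDoubleGain {y} eq = 1+n≰n (≤-trans (s≤s (s≤s z≤n)) (subst (_≤ 1) (raisedBy 2 eq) (count-strict≤1 sκ (suc y))))

  loss : ∀ {y} → N (suc y) ≡ suc (N y) → count (suc y) κ ≡ 0 × count (suc y) prev ≡ 1
  loss {y} eq = swap (≤1∧≡suc⇒ (count-strict≤1 sp (suc y)) prev≡1+κ)
    where
    prev≡1+κ : count (suc y) prev ≡ suc (count (suc y) κ)
    prev≡1+κ = +-cancelʳ-≡ (N y) _ _ (begin
      count (suc y) prev + N y          ≡⟨ balance y ⟨
      count (suc y) κ + N (suc y)       ≡⟨ cong (count (suc y) κ +_) eq ⟩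
      count (suc y) κ + suc (N y)       ≡⟨ +-suc _ _ ⟩
      suc (count (suc y) κ + N y)       ∎)
      where open ≡-Reasoning

sum-nonzero : ∀ xs → sum (nonzero xs) ≡ sum xs
sum-nonzero []           = refl
sum-nonzero (zero ∷ xs)  = sum-nonzero xs
sum-nonzero (suc x ∷ xs) = cong (suc x +_) (sum-nonzero xs)

count-nonzero : ∀ x xs → 1 ≤ x → count x (nonzero xs) ≡ count x xs
count-nonzero x xs 1≤x = count-filterᵇ-kept (1 ≤ᵇ_) xs (≤⇒≤ᵇ≡true 1≤x)

count0-nonzero : ∀ xs → count 0 (nonzero xs) ≡ 0
count0-nonzero xs = count-filterᵇ-dropped (1 ≤ᵇ_) xs refl

-- C lists the parts of κ, padded with zeros
PartsOf : List ℕ → List ℕ → Set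
PartsOf κ C = ∀ x → 1 ≤ x → count x C ≡ count x κ

PartsOf⇒sum≡ : ∀ κ C → PartsOf κ C → sum C ≡ sum κ
PartsOf⇒sum≡ κ C h = begin
  sum C             ≡⟨ sum-nonzero C ⟨
  sum (nonzero C)   ≡⟨ sum-↭ (count⇒↭ (nonzero C) (nonzero κ) same-counts) ⟩
  sum (nonzero κ)   ≡⟨ sum-nonzero κ ⟩
  sum κ             ∎
  where
  open ≡-Reasoning
  same-counts : ∀ k → count k (nonzero C) ≡ count k (nonzero κ)
  same-counts zero    = trans (count0-nonzero C) (sym (count0-nonzero κ))
  same-counts (suc k) = trans (count-nonzero (suc k) C (s≤s z≤n))
                              (trans (h (suc k) (s≤s z≤n)) (sym (count-nonzero (suc k) κ (s≤s z≤n))))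

module _ {prev κ : List ℕ} where

  grow-PartsOf : ∀ {a b} → a < b → count b κ ≡ 1 → count b prev ≡ 0 →
    (1 ≤ a → count a κ ≡ 0 × count a prev ≡ 1) →
    (∀ x → 1 ≤ x → x ≢ a → x ≢ b → count x κ ≡ count x prev) → PartsOf (b ∷ prev) (a ∷ κ)
  grow-PartsOf {a} {b} a<b bκ bprev a-lost others x 1≤x with x ≟ a | x ≟ b
  ... | yes refl | yes x≡b = ⊥-elim (<⇒≢ a<b x≡b)
  ... | yes refl | no  x≢b = begin
    count a (a ∷ κ)      ≡⟨ count-here a κ ⟩
    suc (count a κ)      ≡⟨ cong suc (proj₁ (a-lost 1≤x)) ⟩
    1                    ≡⟨ proj₂ (a-lost 1≤x) ⟨
    count a prev         ≡⟨ count-there prev (≢-sym x≢b) ⟨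
    count a (b ∷ prev)   ∎
    where open ≡-Reasoning
  ... | no  x≢a  | yes refl = begin
    count b (a ∷ κ)      ≡⟨ count-there κ (≢-sym x≢a) ⟩
    count b κ            ≡⟨ bκ ⟩
    1                    ≡⟨ cong suc bprev ⟨
    suc (count b prev)   ≡⟨ count-here b prev ⟨
    count b (b ∷ prev)   ∎
    where open ≡-Reasoning
  ... | no  x≢a  | no  x≢b = begin
    count x (a ∷ κ)      ≡⟨ count-there κ (≢-sym x≢a) ⟩
    count x κ            ≡⟨ others x 1≤x x≢a x≢b ⟩
    count x prev         ≡⟨ count-there prev (≢-sym x≢b) ⟨
    count x (b ∷ prev)   ∎
    where open ≡-Reasoning

  addTwo-PartsOf : ∀ {b₁ b₂} → b₁ ≢ b₂ →
    count b₁ κ ≡ 1 → count b₁ prev ≡ 0 → count b₂ κ ≡ 1 → count b₂ prev ≡ 0 →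
    (∀ x → 1 ≤ x → x ≢ b₁ → x ≢ b₂ → count x κ ≡ count x prev) → PartsOf (b₁ ∷ b₂ ∷ prev) κ
  addTwo-PartsOf {b₁} {b₂} b₁≢b₂ b₁κ b₁prev b₂κ b₂prev others x 1≤x with x ≟ b₁ | x ≟ b₂
  ... | yes refl | yes x≡b₂ = ⊥-elim (b₁≢b₂ x≡b₂)
  ... | yes refl | no  x≢b₂ = begin
    count b₁ κ                  ≡⟨ b₁κ ⟩
    1                           ≡⟨ cong suc (trans (count-there prev (≢-sym x≢b₂)) b₁prev) ⟨
    suc (count b₁ (b₂ ∷ prev))  ≡⟨ count-here b₁ (b₂ ∷ prev) ⟨
    count b₁ (b₁ ∷ b₂ ∷ prev)   ∎
    where open ≡-Reasoning
  ... | no  x≢b₁ | yes refl = begin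
    count b₂ κ                  ≡⟨ b₂κ ⟩
    1                           ≡⟨ cong suc b₂prev ⟨
    suc (count b₂ prev)         ≡⟨ count-here b₂ prev ⟨
    count b₂ (b₂ ∷ prev)        ≡⟨ count-there (b₂ ∷ prev) (≢-sym x≢b₁) ⟨
    count b₂ (b₁ ∷ b₂ ∷ prev)   ∎
    where open ≡-Reasoning
  ... | no  x≢b₁ | no  x≢b₂ = begin
    count x κ                   ≡⟨ others x 1≤x x≢b₁ x≢b₂ ⟩
    count x prev                ≡⟨ count-there prev (≢-sym x≢b₂) ⟨
    count x (b₂ ∷ prev)         ≡⟨ count-there (b₂ ∷ prev) (≢-sym x≢b₁) ⟨
    count x (b₁ ∷ b₂ ∷ prev)    ∎
    where open ≡-Reasoning

interval⇒grow : ∀ {prev κ p D a b} → IsStrictPartition prev → IsStrictPartition κ →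
  (∀ d → partsAbove κ d ≡ partsAbove prev d + count d D) → Interval D a b → sum κ ≡ sum prev + p →
  StripMove prev κ p
interval⇒grow {b = zero} _ _ _ iv _ = ⊥-elim (n≮0 (Interval.a<b iv))
interval⇒grow {prev} {κ} {p} {D} {a} {suc b′} sp sκ diagonals iv sz =
  grow a b a<b b≡a+p bκ bprev a-lost others
  where
  open Interval iv using (a<b; top-edge; bottom-edge; flat)
  open Balance sp sκ (λ d → count d D) diagonals
  b = suc b′
  bκ     = proj₁ (gain (top-edge refl))
  bprev  = proj₂ (gain (top-edge refl))
  a-lost : 1 ≤ a → count a κ ≡ 0 × count a prev ≡ 1
  a-lost (s≤s z≤n) = loss (bottom-edge refl)
  others : ∀ x → 1 ≤ x → x ≢ a → x ≢ b → count x κ ≡ count x prev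
  others (suc y) _ x≢a x≢b = same (flat x≢a x≢b)
  b≡a+p : b ≡ a + p
  b≡a+p = +-cancelʳ-≡ (sum prev) _ _ (begin
    b + sum prev         ≡⟨ PartsOf⇒sum≡ (b ∷ prev) (a ∷ κ) (grow-PartsOf {prev} {κ} a<b bκ bprev a-lost others) ⟨
    a + sum κ            ≡⟨ cong (a +_) sz ⟩
    a + (sum prev + p)   ≡⟨ x∙yz≈xz∙y a (sum prev) p ⟩
    a + p + sum prev     ∎)
    where open ≡-Reasoning

twoIntervals⇒addTwo : ∀ {prev κ p DA DB b₁ b₂} → IsStrictPartition prev → IsStrictPartition κ →
  (∀ d → partsAbove κ d ≡ partsAbove prev d + (count d DA + count d DB)) →
  Interval DA 0 b₁ → Interval DB 0 b₂ → sum κ ≡ sum prev + p → StripMove prev κ p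
twoIntervals⇒addTwo {b₁ = zero} _ _ _ ivA _ _ = ⊥-elim (n≮0 (Interval.a<b ivA))
twoIntervals⇒addTwo {b₂ = zero} _ _ _ _ ivB _ = ⊥-elim (n≮0 (Interval.a<b ivB))
twoIntervals⇒addTwo {prev} {κ} {p} {DA} {DB} {suc y₁} {suc y₂} sp sκ diagonals ivA ivB sz =
  addTwo b₁ b₂ (s≤s z≤n) (s≤s z≤n) b₁≢b₂ p≡b₁+b₂ b₁κ b₁prev b₂κ b₂prev others
  where
  module A = Interval ivA
  module B = Interval ivB
  open Balance sp sκ (λ d → count d DA + count d DB) diagonals
  b₁ = suc y₁
  b₂ = suc y₂
  b₁≢b₂ : b₁ ≢ b₂
  b₁≢b₂ refl = noDoubleGain (trans (cong₂ _+_ (A.top-edge refl) (B.top-edge refl)) (cong suc (+-suc _ _)))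
  b₁-gained = gain (cong₂ _+_ (A.top-edge refl) (sym (B.flat (λ ()) b₁≢b₂)))
  b₂-gained = gain (trans (cong₂ _+_ (sym (A.flat (λ ()) (≢-sym b₁≢b₂))) (B.top-edge refl)) (+-suc _ _))
  b₁κ = proj₁ b₁-gained
  b₁prev = proj₂ b₁-gained
  b₂κ = proj₁ b₂-gained
  b₂prev = proj₂ b₂-gained
  others : ∀ x → 1 ≤ x → x ≢ b₁ → x ≢ b₂ → count x κ ≡ count x prev
  others (suc y) _ x≢b₁ x≢b₂ = same (cong₂ _+_ (A.flat (λ ()) x≢b₁) (B.flat (λ ()) x≢b₂))
  p≡b₁+b₂ : p ≡ b₁ + b₂
  p≡b₁+b₂ = +-cancelˡ-≡ (sum prev) _ _ (begin
    sum prev + p             ≡⟨ sz ⟨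
    sum κ                    ≡⟨ PartsOf⇒sum≡ (b₁ ∷ b₂ ∷ prev) κ (addTwo-PartsOf {prev} {κ} b₁≢b₂ b₁κ b₁prev b₂κ b₂prev others) ⟩
    b₁ + (b₂ + sum prev)     ≡⟨ +-assoc b₁ b₂ (sum prev) ⟨
    b₁ + b₂ + sum prev       ≡⟨ +-comm (b₁ + b₂) (sum prev) ⟩
    sum prev + (b₁ + b₂)     ∎)
    where open ≡-Reasoning

cellsFrom-row≥ : ∀ i as {c} → c ∈ cellsFrom i as → i ≤ proj₁ c
cellsFrom-row≥ i (a ∷ as) c∈ with ∈-++⁻ (map (λ k → (i , i + k)) (upTo a)) c∈
... | inj₂ c∈rest = <⇒≤ (cellsFrom-row≥ (suc i) as c∈rest)
... | inj₁ c∈row with ∈-map⁻ (λ k → (i , i + k)) c∈row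
...   | k , _ , refl = ≤-refl

cellsFrom-Unique : ∀ i as → Unique (cellsFrom i as)
cellsFrom-Unique i []       = []
cellsFrom-Unique i (a ∷ as) = Unique.++⁺ (Unique.map⁺ row-injective (Unique.upTo⁺ a)) (cellsFrom-Unique (suc i) as) disjoint
  where
  row-injective : ∀ {x y} → (i , i + x) ≡ (i , i + y) → x ≡ y
  row-injective eq = +-cancelˡ-≡ i _ _ (cong proj₂ eq)
  disjoint : ∀ {c} → ¬ (c ∈ map (λ k → (i , i + k)) (upTo a) × c ∈ cellsFrom (suc i) as)
  disjoint (c∈row , c∈rest) with ∈-map⁻ (λ k → (i , i + k)) c∈row
  ... | k , _ , refl = 1+n≰n (cellsFrom-row≥ (suc i) as c∈rest)

skew-Unique : ∀ κ prev → Unique (skew κ prev)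
skew-Unique κ prev = Unique.filter⁺ _ (cellsFrom-Unique 1 κ)

subsets-⊆ : ∀ {A : Set} (xs : List A) {B} → B ∈ subsets xs → ∀ {y} → y ∈ B → y ∈ xs
subsets-⊆ []       (here refl) ()
subsets-⊆ (x ∷ xs) B∈ y∈ with ∈-++⁻ (subsets xs) B∈
... | inj₁ B∈′ = there (subsets-⊆ xs B∈′ y∈)
... | inj₂ B∈″ with ∈-map⁻ (x ∷_) B∈″ | y∈
...   | B′ , _   , refl | here refl = here refl
...   | B′ , B′∈ , refl | there y∈′ = there (subsets-⊆ xs B′∈ y∈′)

cellEq-refl : ∀ c → cellEq c c ≡ true
cellEq-refl (i , j) rewrite ≡ᵇ-refl i | ≡ᵇ-refl j = refl

≢⇒cellEq≡false : ∀ {y x} → y ≢ x → cellEq y x ≡ false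
≢⇒cellEq≡false {y} {x} y≢x with cellEq y x in eq
... | false = refl
... | true  = ⊥-elim (y≢x (cellEq⇒≡ y x (≡true⇒T eq)))

∉⇒elemC≡false : ∀ {x A} → x ∉ A → elemC x A ≡ false
∉⇒elemC≡false {x} {A} x∉ with elemC x A in eq
... | false = refl
... | true with y , y∈ , x≡y ← any-find (cellEq x) A (≡true⇒T eq) = ⊥-elim (x∉ (subst (_∈ A) (sym (cellEq⇒≡ x y x≡y)) y∈))

filterᵇ-cong : ∀ {A : Set} (p q : A → Bool) xs → (∀ {y} → y ∈ xs → p y ≡ q y) → filterᵇ p xs ≡ filterᵇ q xs
filterᵇ-cong p q []       _ = refl
filterᵇ-cong p q (x ∷ xs) h with p x | q x | h (here refl)
... | true  | true  | _ = cong (x ∷_) (filterᵇ-cong p q xs (h ∘ there))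
... | false | false | _ = filterᵇ-cong p q xs (h ∘ there)

diagCount-split : ∀ L {A} → Unique L → A ∈ subsets L → ∀ d →
  diagCount L d ≡ diagCount A d + diagCount (minus L A) d
diagCount-split []       []          (here refl) d = refl
diagCount-split (x ∷ xs) {A} (x∉ ∷ uxs) A∈ d with ∈-++⁻ (subsets xs) A∈
... | inj₁ A∈′
  rewrite filterᵇ-accept (not ∘ (λ c → elemC c A)) x xs
            (cong not (∉⇒elemC≡false (λ x∈A → All.lookup x∉ (subsets-⊆ xs A∈′ x∈A) refl)))
        | countℕ-∷ (_≡ᵇ d) (diag x) (map diag xs) | countℕ-∷ (_≡ᵇ d) (diag x) (map diag (minus xs A))
        | diagCount-split xs uxs A∈′ d
  = x∙yz≈y∙xz (indicator (diag x ≡ᵇ d)) (diagCount A d) (diagCount (minus xs A) d)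
... | inj₂ A∈″ with ∈-map⁻ (x ∷_) A∈″
...   | A′ , A′∈ , refl
  rewrite filterᵇ-reject (not ∘ (λ c → elemC c (x ∷ A′))) x xs (cong not (cong (_∨ elemC x A′) (cellEq-refl x)))
        | filterᵇ-cong (not ∘ (λ c → elemC c (x ∷ A′))) (not ∘ (λ c → elemC c A′)) xs
            (λ y∈ → cong (λ b → not (b ∨ _)) (≢⇒cellEq≡false (λ y≡x → All.lookup x∉ (subst (_∈ xs) y≡x y∈) refl)))
        | countℕ-∷ (_≡ᵇ d) (diag x) (map diag xs) | countℕ-∷ (_≡ᵇ d) (diag x) (map diag A′)
        | diagCount-split xs uxs A′∈ d
  = sym (+-assoc (indicator (diag x ≡ᵇ d)) _ _)

noAddedCells⇒p≡0 : ∀ {prev κ p} → IsStrictPartition prev → IsStrictPartition κ →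
  (∀ d → partsAbove κ d ≡ partsAbove prev d + 0) → sum κ ≡ sum prev + p → p ≡ 0
noAddedCells⇒p≡0 {prev} {κ} {p} sp sκ diagonals sz =
  +-cancelˡ-≡ (sum prev) p 0 (trans (sym sz) (trans (PartsOf⇒sum≡ prev κ unchanged) (sym (+-identityʳ _))))
  where
  open Balance sp sκ (λ _ → 0) diagonals
  unchanged : PartsOf prev κ
  unchanged (suc k) _ = same refl

module _ {prev κ p} (sp : IsStrictPartition prev) (sκ : IsStrictPartition κ) (sz : sum κ ≡ sum prev + p) where

  strip⇒StripMove : 1 ≤ p → ∀ L → (∀ {c} → c ∈ L → Shifted c) → T (isStrip L) →
    (∀ d → partsAbove κ d ≡ partsAbove prev d + diagCount L d) → StripMove prev κ p
  strip⇒StripMove 1≤p []       _       _     diagonals = ⊥-elim (n>0⇒n≢0 1≤p (noAddedCells⇒p≡0 sp sκ diagonals sz))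
  strip⇒StripMove 1≤p (c ∷ cs) shifted strip diagonals
    with _ , _ , iv ← strip⇒Interval c cs shifted strip = interval⇒grow sp sκ diagonals iv sz

  doubleStrip⇒StripMove : ∀ L → Unique L → (∀ {c} → c ∈ L → Shifted c) → T (isDoubleStrip L) →
    (∀ d → partsAbove κ d ≡ partsAbove prev d + diagCount L d) → StripMove prev κ p
  doubleStrip⇒StripMove L uL shifted double diagonals
    with A , A∈ , split ← any-find (λ A → isStrip A ∧ isStrip (minus L A) ∧ startsOnMain A ∧ startsOnMain (minus L A))
                                  (subsets L) double
    with stripA , split′  ← Equivalence.to T-∧ split
    with stripB , split″  ← Equivalence.to T-∧ split′
    with mainA  , mainB   ← Equivalence.to T-∧ split″
    with b₁ , ivA ← mainStrip⇒Interval A (shifted ∘ subsets-⊆ L A∈) stripA mainA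
    with b₂ , ivB ← mainStrip⇒Interval (minus L A) (shifted ∘ proj₁ ∘ ∈-filter⁻ (T? ∘ (not ∘ λ c → elemC c A)) {xs = L})
                                       stripB mainB
    = twoIntervals⇒addTwo sp sκ (λ d → trans (diagonals d) (cong (partsAbove prev d +_) (diagCount-split L uL A∈ d))) ivA ivB sz

validStep⇒StripMove : ∀ la prev κ p → IsStrictPartition prev → IsStrictPartition κ → 1 ≤ p →
  T (validStep la prev κ p) → StripMove prev κ p
validStep⇒StripMove la prev κ p sp sκ 1≤p valid
  with sub , t       ← Equivalence.to (T-∧ {subᵇ prev κ}) valid
  with _ , t′        ← Equivalence.to (T-∧ {subᵇ κ la}) t
  with sizes , shape ← Equivalence.to (T-∧ {size κ ≡ᵇ size prev + p}) t′
  = [ (λ strip  → strip⇒StripMove sp sκ sz 1≤p L (skew-Shifted κ prev) strip diagonals)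
    , (λ double → doubleStrip⇒StripMove sp sκ sz L (skew-Unique κ prev) (skew-Shifted κ prev) double diagonals)
    ]′ (Equivalence.to T-∨ shape)
  where
  L = skew κ prev
  sz = ≡ᵇ⇒≡ _ _ sizes
  diagonals = partsAbove-skew prev κ (proj₁ sp) sub

-- Strip tableaux as chains of strip moves

data Chain (la : List ℕ) : List ℕ → List ℕ → Set where
  stop : Chain la la []
  move : ∀ {prev κ p π} → IsStrictPartition κ → StripMove prev κ p → Chain la κ π → Chain la prev (p ∷ π)

strictUpTo⇒strict : ∀ n {κ} → κ ∈ strictUpTo n → IsStrictPartition κ × All (_≤ n) κ
strictUpTo⇒strict zero    (here refl) = ([] , Linked.[]) , []
strictUpTo⇒strict (suc n) κ∈ with ∈-++⁻ (strictUpTo n) κ∈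
... | inj₁ κ∈′ with strictUpTo⇒strict n κ∈′
...   | sκ , ≤n = sκ , All.map m≤n⇒m≤1+n ≤n
strictUpTo⇒strict (suc n) κ∈ | inj₂ κ∈″ with ∈-map⁻ (suc n ∷_) κ∈″
...   | κ′ , κ′∈ , refl with strictUpTo⇒strict n κ′∈
...     | (pos , decreasing) , ≤n = (s≤s z≤n ∷ pos , headBelow κ′ decreasing ≤n) , ≤-refl ∷ All.map m≤n⇒m≤1+n ≤n
  where
  headBelow : ∀ xs → Linked _>_ xs → All (_≤ n) xs → Linked _>_ (suc n ∷ xs)
  headBelow []       _ _        = Linked.[-]
  headBelow (y ∷ ys) l (y≤n ∷ _) = s≤s y≤n Linked.∷ l

eqℕsᵇ⇒≡ : ∀ xs ys → T (eqℕsᵇ xs ys) → xs ≡ ys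
eqℕsᵇ⇒≡ []       []       _ = refl
eqℕsᵇ⇒≡ (x ∷ xs) (y ∷ ys) t with x≡y , rest ← Equivalence.to (T-∧ {x ≡ᵇ y}) t
  = cong₂ _∷_ (≡ᵇ⇒≡ x y x≡y) (eqℕsᵇ⇒≡ xs ys rest)

stripTableau⇒Chain : ∀ la prev π {t} → IsStrictPartition prev → All (1 ≤_) π → t ∈ stripTableaux la prev π →
  Chain la prev π
stripTableau⇒Chain la prev [] _ _ t∈ with eqℕsᵇ prev la in eq
... | true rewrite eqℕsᵇ⇒≡ prev la (≡true⇒T eq) = stop
stripTableau⇒Chain la prev (p ∷ π) sp (1≤p ∷ 1≤π) t∈
  with ts , t∈ts , ts∈ ← ∈-concat⁻′ (map (λ κ → map (κ ∷_) (stripTableaux la κ π))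
                                         (filterᵇ (λ κ → validStep la prev κ p) (strictUpTo (part la 1)))) t∈
  with κ , κ∈ , refl ← ∈-map⁻ (λ κ → map (κ ∷_) (stripTableaux la κ π)) ts∈
  with t′ , t′∈ , refl ← ∈-map⁻ (κ ∷_) t∈ts
  with κ∈strict , valid ← ∈-filter⁻ (T? ∘ (λ κ → validStep la prev κ p)) {xs = strictUpTo (part la 1)} κ∈
  with sκ ← proj₁ (strictUpTo⇒strict (part la 1) κ∈strict)
  = move sκ (validStep⇒StripMove la prev κ p sp sκ 1≤p valid) (stripTableau⇒Chain la κ π sκ 1≤π t′∈)

if-same : ∀ {A : Set} b {x y : A} → x ≡ y → (if b then x else y) ≡ y
if-same true  x≡y = x≡y
if-same false _   = refl

coeffQ≢0⇒allOdd : ∀ la mu ν → coeffQ la mu ν ≢ 0ℚ → T (allOdd ν)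
coeffQ≢0⇒allOdd la mu ν ≢0 with allOdd ν
... | true  = tt
... | false = ⊥-elim (≢0 refl)

coeffQ≢0⇒stripTableau : ∀ la mu ν → coeffQ la mu ν ≢ 0ℚ → ∃ λ t → t ∈ stripTableaux la mu ν
coeffQ≢0⇒stripTableau la mu ν ≢0 with stripTableaux la mu ν
... | t ∷ _ = t , here refl
... | []    = ⊥-elim (≢0 (if-same (allOdd ν) (begin
    ℚ._/_ (ℤ.+ (2 ^ length ν) ℤ.* ℤ.+ 0) (z ν) {{z-nonZero ν}}
      ≡⟨ cong (λ w → ℚ._/_ w (z ν) {{z-nonZero ν}}) (ℤ.*-zeroʳ (ℤ.+ (2 ^ length ν))) ⟩
    ℚ._/_ (ℤ.+ 0) (z ν) {{z-nonZero ν}}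
      ≡⟨ ℚ.0/n≡0 (z ν) {{z-nonZero ν}} ⟩
    0ℚ ∎)))
  where open ≡-Reasoning

replace : ℕ → ℕ → ℕ → ℕ
replace b a y = if y ≡ᵇ b then a else y

replace-hit : ∀ b a → replace b a b ≡ a
replace-hit b a rewrite ≡ᵇ-refl b = refl

replace-miss : ∀ {b} a {y} → y ≢ b → replace b a y ≡ y
replace-miss a y≢b rewrite ≢⇒≡ᵇ≡false y≢b = refl

undo : ∀ {prev κ p} → StripMove prev κ p → ℕ → ℕ
undo (grow a b _ _ _ _ _ _)            = replace b a
undo (addTwo b₁ b₂ _ _ _ _ _ _ _ _ _) = replace b₁ 0 ∘ replace b₂ 0

replace-≤ : ∀ b a y → a ≤ b → replace b a y ≤ y
replace-≤ b a y a≤b with y ≟ b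
... | yes refl rewrite replace-hit y a = a≤b
... | no  y≢b  rewrite replace-miss a y≢b = ≤-refl

undo-≤ : ∀ {prev κ p} (s : StripMove prev κ p) y → undo s y ≤ y
undo-≤ (grow a b a<b _ _ _ _ _)            y = replace-≤ b a y (<⇒≤ a<b)
undo-≤ (addTwo b₁ b₂ _ _ _ _ _ _ _ _ _) y = ≤-trans (replace-≤ b₁ 0 _ z≤n) (replace-≤ b₂ 0 y z≤n)

replace-0 : ∀ {b} a → 1 ≤ b → replace b a 0 ≡ 0
replace-0 a 1≤b = replace-miss a (≢-sym (n>0⇒n≢0 1≤b))

undo-0 : ∀ {prev κ p} (s : StripMove prev κ p) → undo s 0 ≡ 0
undo-0 (grow a b a<b _ _ _ _ _) = replace-0 a (<-≤-trans (s≤s z≤n) a<b)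
undo-0 (addTwo b₁ b₂ 1≤b₁ 1≤b₂ _ _ _ _ _ _ _) rewrite replace-0 0 1≤b₂ = replace-0 0 1≤b₁

count-replace-target : ∀ b a C → a ≢ b → count a (map (replace b a) C) ≡ count a C + count b C
count-replace-target b a []      _   = refl
count-replace-target b a (c ∷ C) a≢b with c ≟ b
... | yes refl rewrite replace-hit c a | count-here a (map (replace c a) C) | count-there {a} C (≢-sym a≢b)
                     | count-here c C | count-replace-target c a C a≢b = sym (+-suc _ _)
... | no  c≢b  rewrite replace-miss a c≢b | count-there {b} C c≢b with c ≟ a
...   | yes refl rewrite count-here c (map (replace b c) C) | count-here c C | count-replace-target b c C a≢b = refl
...   | no  c≢a  rewrite count-there (map (replace b a) C) c≢a | count-there C c≢a = count-replace-target b a C a≢b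

count-replace-source : ∀ b a C → a ≢ b → count b (map (replace b a) C) ≡ 0
count-replace-source b a []      _   = refl
count-replace-source b a (c ∷ C) a≢b with c ≟ b
... | yes refl rewrite replace-hit c a | count-there (map (replace c a) C) a≢b = count-replace-source c a C a≢b
... | no  c≢b  rewrite replace-miss a c≢b | count-there (map (replace b a) C) c≢b = count-replace-source b a C a≢b

count-replace-other : ∀ b a C {x} → x ≢ a → x ≢ b → count x (map (replace b a) C) ≡ count x C
count-replace-other b a []      _   _   = refl
count-replace-other b a (c ∷ C) {x} x≢a x≢b with c ≟ b
... | yes refl rewrite replace-hit c a | count-there (map (replace c a) C) (≢-sym x≢a) | count-there C (≢-sym x≢b)
  = count-replace-other c a C x≢a x≢b
... | no  c≢b  rewrite replace-miss a c≢b with c ≟ x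
...   | yes refl rewrite count-here c (map (replace b a) C) | count-here c C = cong suc (count-replace-other b a C x≢a x≢b)
...   | no  c≢x  rewrite count-there (map (replace b a) C) c≢x | count-there C c≢x = count-replace-other b a C x≢a x≢b

undo-PartsOf : ∀ {prev κ p} (s : StripMove prev κ p) C → PartsOf κ C → PartsOf prev (map (undo s) C)
undo-PartsOf {prev} {κ} (grow a b a<b _ bκ bprev a-lost others) C h x 1≤x with x ≟ b | x ≟ a
... | yes refl | yes x≡a = ⊥-elim (<⇒≢ a<b (sym x≡a))
... | yes refl | no  x≢a = trans (count-replace-source x a C (≢-sym x≢a)) (sym bprev)
... | no  x≢b  | yes refl = begin
  count x (map (replace b x) C)  ≡⟨ count-replace-target b x C x≢b ⟩
  count x C + count b C          ≡⟨ cong₂ _+_ (h x 1≤x) (h b (≤-trans 1≤x (<⇒≤ a<b))) ⟩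
  count x κ + count b κ          ≡⟨ cong₂ _+_ (proj₁ (a-lost 1≤x)) bκ ⟩
  1                              ≡⟨ proj₂ (a-lost 1≤x) ⟨
  count x prev                   ∎
  where open ≡-Reasoning
... | no  x≢b  | no  x≢a  = trans (count-replace-other b a C x≢a x≢b) (trans (h x 1≤x) (others x 1≤x x≢a x≢b))
undo-PartsOf (addTwo b₁ b₂ 1≤b₁ 1≤b₂ _ _ _ b₁prev _ b₂prev others) C h x 1≤x
  rewrite map-∘ {g = replace b₁ 0} {f = replace b₂ 0} C with x ≟ b₁ | x ≟ b₂
... | yes refl | _        = trans (count-replace-source x 0 (map (replace b₂ 0) C) (n>0⇒n≢0 1≤b₁ ∘ sym)) (sym b₁prev)
... | no  x≢b₁ | yes refl =
  trans (count-replace-other b₁ 0 (map (replace x 0) C) (n>0⇒n≢0 1≤x) x≢b₁)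
        (trans (count-replace-source x 0 C (n>0⇒n≢0 1≤b₂ ∘ sym)) (sym b₂prev))
... | no  x≢b₁ | no  x≢b₂ =
  trans (count-replace-other b₁ 0 (map (replace b₂ 0) C) (n>0⇒n≢0 1≤x) x≢b₁)
        (trans (count-replace-other b₂ 0 C (n>0⇒n≢0 1≤x) x≢b₂) (trans (h x 1≤x) (others x 1≤x x≢b₁ x≢b₂)))

sum-replace-drop : ∀ b a C → a ≤ b → sum (map (λ c → c ∸ replace b a c) C) ≡ count b C * (b ∸ a)
sum-replace-drop b a []      _   = refl
sum-replace-drop b a (c ∷ C) a≤b with c ≟ b
... | yes refl rewrite replace-hit c a | count-here c C | sum-replace-drop c a C a≤b = refl
... | no  c≢b  rewrite replace-miss a c≢b | count-there C c≢b | n∸n≡0 c = sum-replace-drop b a C a≤b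

sum-replace₂-drop : ∀ b₁ b₂ C → 1 ≤ b₁ → 1 ≤ b₂ → b₁ ≢ b₂ →
  sum (map (λ c → c ∸ replace b₁ 0 (replace b₂ 0 c)) C) ≡ count b₁ C * b₁ + count b₂ C * b₂
sum-replace₂-drop b₁ b₂ []      _   _   _     = refl
sum-replace₂-drop b₁ b₂ (c ∷ C) 1≤b₁ 1≤b₂ b₁≢b₂ with c ≟ b₂
... | yes refl rewrite replace-hit c 0 | replace-0 0 1≤b₁ | count-here c C | count-there C (≢-sym b₁≢b₂)
                     | sum-replace₂-drop b₁ c C 1≤b₁ 1≤b₂ b₁≢b₂
  = x∙yz≈y∙xz c (count b₁ C * b₁) (count c C * c)
... | no c≢b₂ rewrite replace-miss 0 c≢b₂ | count-there C c≢b₂ with c ≟ b₁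
...   | yes refl rewrite replace-hit c 0 | count-here c C | sum-replace₂-drop c b₂ C 1≤b₁ 1≤b₂ b₁≢b₂
  = sym (+-assoc c (count c C * c) (count b₂ C * b₂))
...   | no c≢b₁ rewrite replace-miss 0 c≢b₁ | count-there C c≢b₁ | n∸n≡0 c = sum-replace₂-drop b₁ b₂ C 1≤b₁ 1≤b₂ b₁≢b₂

undo-total-drop : ∀ {prev κ p} (s : StripMove prev κ p) C → PartsOf κ C → sum (map (λ c → c ∸ undo s c) C) ≡ p
undo-total-drop (grow a b a<b b≡a+p bκ _ _ _) C h
  rewrite sum-replace-drop b a C (<⇒≤ a<b) | h b (<-≤-trans (s≤s z≤n) a<b) | bκ | b≡a+p
  = trans (+-identityʳ _) (m+n∸m≡n a _)
undo-total-drop (addTwo b₁ b₂ 1≤b₁ 1≤b₂ b₁≢b₂ p≡ b₁κ _ b₂κ _ _) C h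
  rewrite sum-replace₂-drop b₁ b₂ C 1≤b₁ 1≤b₂ b₁≢b₂ | h b₁ 1≤b₁ | h b₂ 1≤b₂ | b₁κ | b₂κ | p≡
  = cong₂ _+_ (+-identityʳ b₁) (+-identityʳ b₂)

length-filterᵇ-cong : ∀ {A : Set} (q r : A → Bool) xs → (∀ x → q x ≡ r x) →
  length (filterᵇ q xs) ≡ length (filterᵇ r xs)
length-filterᵇ-cong q r []       _   = refl
length-filterᵇ-cong q r (x ∷ xs) q≗r rewrite q≗r x with r x
... | true  = cong suc (length-filterᵇ-cong q r xs q≗r)
... | false = length-filterᵇ-cong q r xs q≗r

count-∨ : ∀ b₁ b₂ C → b₁ ≢ b₂ → countℕ (λ c → (c ≡ᵇ b₁) ∨ (c ≡ᵇ b₂)) C ≡ count b₁ C + count b₂ C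
count-∨ b₁ b₂ []      _ = refl
count-∨ b₁ b₂ (c ∷ C) b₁≢b₂
  rewrite countℕ-∷ (λ c → (c ≡ᵇ b₁) ∨ (c ≡ᵇ b₂)) c C | countℕ-∷ (_≡ᵇ b₁) c C | countℕ-∷ (_≡ᵇ b₂) c C
        | count-∨ b₁ b₂ C b₁≢b₂ with c ≟ b₁ | c ≟ b₂
... | yes refl | yes c≡b₂ = ⊥-elim (b₁≢b₂ c≡b₂)
... | yes refl | no  c≢b₂ rewrite ≡ᵇ-refl c | ≢⇒≡ᵇ≡false c≢b₂ = refl
... | no  c≢b₁ | yes refl rewrite ≡ᵇ-refl c | ≢⇒≡ᵇ≡false c≢b₁ = sym (+-suc _ _)
... | no  c≢b₁ | no  c≢b₂ rewrite ≢⇒≡ᵇ≡false c≢b₁ | ≢⇒≡ᵇ≡false c≢b₂ = refl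

undo-lowers : ∀ {prev κ p} (s : StripMove prev κ p) C → PartsOf κ C →
  countℕ (λ c → undo s c <ᵇ c) C ≡ 1 ⊎ (countℕ (λ c → undo s c <ᵇ c) C ≡ 2 × (∀ c → undo s c < c → undo s c ≡ 0))
undo-lowers (grow a b a<b _ bκ _ _ _) C h =
  inj₁ (trans (length-filterᵇ-cong _ _ C lowered≗b) (trans (h b (<-≤-trans (s≤s z≤n) a<b)) bκ))
  where
  lowered≗b : ∀ c → (replace b a c <ᵇ c) ≡ (c ≡ᵇ b)
  lowered≗b c with c ≟ b
  ... | yes refl rewrite replace-hit c a | ≡ᵇ-refl c = <⇒<ᵇ≡true a<b
  ... | no  c≢b  rewrite replace-miss a c≢b | ≢⇒≡ᵇ≡false c≢b = ≤⇒<ᵇ≡false (≤-refl {c})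
undo-lowers (addTwo b₁ b₂ 1≤b₁ 1≤b₂ b₁≢b₂ _ b₁κ _ b₂κ _ _) C h =
  inj₂ (trans (length-filterᵇ-cong _ _ C lowered≗b₁∨b₂)
              (trans (count-∨ b₁ b₂ C b₁≢b₂) (cong₂ _+_ (trans (h b₁ 1≤b₁) b₁κ) (trans (h b₂ 1≤b₂) b₂κ)))
       , lowered-to-0)
  where
  lowered≗b₁∨b₂ : ∀ c → (replace b₁ 0 (replace b₂ 0 c) <ᵇ c) ≡ ((c ≡ᵇ b₁) ∨ (c ≡ᵇ b₂))
  lowered≗b₁∨b₂ c with c ≟ b₂
  ... | yes refl rewrite replace-hit c 0 | replace-0 0 1≤b₁ | ≡ᵇ-refl c | <⇒<ᵇ≡true 1≤b₂ with c ≡ᵇ b₁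
  ...   | true  = refl
  ...   | false = refl
  lowered≗b₁∨b₂ c | no c≢b₂ rewrite replace-miss 0 c≢b₂ | ≢⇒≡ᵇ≡false c≢b₂ with c ≟ b₁
  ...   | yes refl rewrite replace-hit c 0 | ≡ᵇ-refl c = <⇒<ᵇ≡true 1≤b₁
  ...   | no  c≢b₁ rewrite replace-miss 0 c≢b₁ | ≢⇒≡ᵇ≡false c≢b₁ = ≤⇒<ᵇ≡false (≤-refl {c})
  lowered-to-0 : ∀ c → replace b₁ 0 (replace b₂ 0 c) < c → replace b₁ 0 (replace b₂ 0 c) ≡ 0
  lowered-to-0 c lt with c ≟ b₂
  ... | yes refl rewrite replace-hit c 0 = replace-0 0 1≤b₁
  ... | no  c≢b₂ rewrite replace-miss 0 c≢b₂ with c ≟ b₁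
  ...   | yes refl = replace-hit c 0
  ...   | no  c≢b₁ rewrite replace-miss 0 c≢b₁ = ⊥-elim (<-irrefl refl lt)

countℕ-replicate-accept : ∀ (q : ℕ → Bool) n x → q x ≡ true → countℕ q (replicate n x) ≡ n
countℕ-replicate-accept q n x qx = trans (cong length (filter-all (T? ∘ q) (replicate⁺ n (≡true⇒T qx)))) (length-replicate n)

countℕ-none : ∀ (q : ℕ → Bool) {xs} → All (λ e → q e ≡ false) xs → countℕ q xs ≡ 0
countℕ-none q none = cong length (filter-none (T? ∘ q) (All.map (λ qe t → subst T qe t) none))

countℕ-replicate-reject : ∀ (q : ℕ → Bool) n x → q x ≡ false → countℕ q (replicate n x) ≡ 0
countℕ-replicate-reject q n x qx = countℕ-none q (replicate⁺ n qx)

∷-sorted : ∀ {x xs} → All (x ≤_) xs → Linked _≤_ xs → Linked _≤_ (x ∷ xs)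
∷-sorted []           _ = Linked.[-]
∷-sorted (x≤y ∷ _) l  = x≤y Linked.∷ l

replicate++-sorted : ∀ n x {xs} → All (x ≤_) xs → Linked _≤_ xs → Linked _≤_ (replicate n x ++ xs)
replicate++-sorted zero    x _    l = l
replicate++-sorted (suc n) x x≤xs l = ∷-sorted (++⁺ (replicate⁺ n ≤-refl) x≤xs) (replicate++-sorted n x x≤xs l)

module _ {la : List ℕ} where

  ancestor : ∀ {prev π} → Chain la prev π → ℕ → ℕ
  ancestor stop         y = y
  ancestor (move _ s ch) y = undo s (ancestor ch y)

  -- the part of row y added by the i-th move is filled with the label o + i
  labels : ∀ {prev π} → ℕ → Chain la prev π → ℕ → List ℕ
  labels o stop          y = []
  labels o (move _ s ch) y = replicate (ancestor ch y ∸ undo s (ancestor ch y)) (suc o) ++ labels (suc o) ch y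

  barRow : ∀ {prev π} → Chain la prev π → ℕ → List ℕ
  barRow ch y = replicate (ancestor ch y) 0 ++ labels 0 ch y

  -- the length of row y in the m-th shape of the chain
  stage : ∀ {prev π} → Chain la prev π → ℕ → ℕ → ℕ
  stage ch            zero    y = ancestor ch y
  stage stop          (suc m) y = y
  stage (move _ _ ch) (suc m) y = stage ch m y

  ancestor+length-labels : ∀ {prev π} o (ch : Chain la prev π) y → ancestor ch y + length (labels o ch y) ≡ y
  ancestor+length-labels o stop          y = +-identityʳ y
  ancestor+length-labels o (move _ s ch) y
    rewrite length-++ (replicate (ancestor ch y ∸ undo s (ancestor ch y)) (suc o)) {labels (suc o) ch y}
          | length-replicate (ancestor ch y ∸ undo s (ancestor ch y)) {suc o}
          | sym (+-assoc (undo s (ancestor ch y)) (ancestor ch y ∸ undo s (ancestor ch y)) (length (labels (suc o) ch y)))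
          | m+[n∸m]≡n (undo-≤ s (ancestor ch y))
    = ancestor+length-labels (suc o) ch y

  labels-range : ∀ {prev π} o (ch : Chain la prev π) y → All (λ e → o < e × e ≤ o + length π) (labels o ch y)
  labels-range o stop y = []
  labels-range {π = p ∷ π} o (move _ s ch) y =
    ++⁺ (replicate⁺ _ (≤-refl , ≤-trans (s≤s (m≤m+n o (length π))) o+1+len))
        (All.map (λ (o+1<e , e≤) → <-trans ≤-refl o+1<e , ≤-trans e≤ o+1+len) (labels-range (suc o) ch y))
    where
    o+1+len : suc o + length π ≤ o + length (p ∷ π)
    o+1+len = ≤-reflexive (sym (+-suc o (length π)))

  labels-sorted : ∀ {prev π} o (ch : Chain la prev π) y → Linked _≤_ (labels o ch y)
  labels-sorted o stop          y = Linked.[]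
  labels-sorted o (move _ s ch) y =
    replicate++-sorted _ (suc o) (All.map (λ (o+1<e , _) → <⇒≤ o+1<e) (labels-range (suc o) ch y)) (labels-sorted (suc o) ch y)

  barRow-sorted : ∀ {prev π} (ch : Chain la prev π) y → Linked _≤_ (barRow ch y)
  barRow-sorted ch y = replicate++-sorted _ 0 (All.map (λ _ → z≤n) (labels-range 0 ch y)) (labels-sorted 0 ch y)

  count-labels-≤ : ∀ {prev π} o (ch : Chain la prev π) y {k} → k ≤ o → count k (labels o ch y) ≡ 0
  count-labels-≤ o ch y k≤o =
    countℕ-none (_≡ᵇ _)
      (All.map (λ (o<e , _) → ≢⇒≡ᵇ≡false (λ e≡k → <⇒≱ o<e (≤-trans (≤-reflexive e≡k) k≤o))) (labels-range o ch y))

  count-labels-now : ∀ {prev κ p π} o (sκ : IsStrictPartition κ) (s : StripMove prev κ p) (ch : Chain la κ π) y →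
    count (suc o) (labels o (move sκ s ch) y) ≡ ancestor ch y ∸ undo s (ancestor ch y)
  count-labels-now o sκ s ch y =
    trans (countℕ-++ (_≡ᵇ suc o) (replicate (ancestor ch y ∸ undo s (ancestor ch y)) (suc o)) (labels (suc o) ch y))
          (trans (cong₂ _+_ (countℕ-replicate-accept (_≡ᵇ suc o) _ (suc o) (≡ᵇ-refl (suc o))) (count-labels-≤ (suc o) ch y ≤-refl))
                 (+-identityʳ _))

  count-labels-later : ∀ {prev κ p π} o (sκ : IsStrictPartition κ) (s : StripMove prev κ p) (ch : Chain la κ π) y {k} →
    suc o ≢ k → count k (labels o (move sκ s ch) y) ≡ count k (labels (suc o) ch y)
  count-labels-later o sκ s ch y {k} o+1≢k =
    trans (countℕ-++ (_≡ᵇ k) (replicate (ancestor ch y ∸ undo s (ancestor ch y)) (suc o)) (labels (suc o) ch y))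
          (cong (_+ count k (labels (suc o) ch y))
                (countℕ-replicate-reject (_≡ᵇ k) (ancestor ch y ∸ undo s (ancestor ch y)) (suc o) (≢⇒≡ᵇ≡false o+1≢k)))

  ancestor-PartsOf : ∀ {prev π} (ch : Chain la prev π) → PartsOf prev (map (ancestor ch) la)
  ancestor-PartsOf stop         x _   = cong (count x) (map-id la)
  ancestor-PartsOf (move _ s ch) x 1≤x =
    trans (cong (count x) (map-∘ {g = undo s} {f = ancestor ch} la))
          (undo-PartsOf s (map (ancestor ch) la) (ancestor-PartsOf ch) x 1≤x)

  stage-stop : ∀ m y → stage {la} {[]} stop m y ≡ y
  stage-stop zero    y = refl
  stage-stop (suc m) y = refl

  ancestor+labels≤ : ∀ {prev π} o (ch : Chain la prev π) y i → o ≤ i →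
    ancestor ch y + countℕ (_≤ᵇ i) (labels o ch y) ≡ stage ch (i ∸ o) y
  ancestor+labels≤ o stop          y i _   = trans (+-identityʳ y) (sym (stage-stop (i ∸ o) y))
  ancestor+labels≤ o (move sκ s ch) y i o≤i with m≤n⇒m<n∨m≡n o≤i
  ... | inj₂ refl rewrite n∸n≡0 o =
    trans (cong (undo s (ancestor ch y) +_)
                (countℕ-none (_≤ᵇ o) (All.map (λ (o<e , _) → <⇒≤ᵇ≡false o<e) (labels-range o (move sκ s ch) y))))
          (+-identityʳ _)
  ... | inj₁ o<i
    rewrite +-∸-assoc 1 o<i
          | countℕ-++ (_≤ᵇ i) (replicate (ancestor ch y ∸ undo s (ancestor ch y)) (suc o)) (labels (suc o) ch y)
          | countℕ-replicate-accept (_≤ᵇ i) (ancestor ch y ∸ undo s (ancestor ch y)) (suc o) (≤⇒≤ᵇ≡true o<i)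
          | sym (+-assoc (undo s (ancestor ch y)) (ancestor ch y ∸ undo s (ancestor ch y)) (countℕ (_≤ᵇ i) (labels (suc o) ch y)))
          | m+[n∸m]≡n (undo-≤ s (ancestor ch y))
    = ancestor+labels≤ (suc o) ch y i o<i

  stage-strict : ∀ {prev π} (ch : Chain la prev π) → IsStrictPartition prev → IsStrictPartition la → ∀ m →
    ∃ λ σ → IsStrictPartition σ × PartsOf σ (map (stage ch m) la)
  stage-strict ch            sp _  zero    = _ , sp , ancestor-PartsOf ch
  stage-strict stop          _  sl (suc m) = la , sl , λ x _ → cong (count x) (map-id la)
  stage-strict (move sκ _ ch) _  sl (suc m) = stage-strict ch sκ sl m

  -- the move that introduced label k, and the parts it acted on
  record LabelSource {prev π} (o : ℕ) (ch : Chain la prev π) (k : ℕ) : Set where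
    field
      {before after} : List ℕ
      moveSize       : ℕ
      source         : StripMove before after moveSize
      parts          : ℕ → ℕ
      parts-PartsOf  : PartsOf after (map parts la)
      moveSize∈      : moveSize ∈ π
      count≡         : ∀ y → count k (labels o ch y) ≡ parts y ∸ undo source (parts y)
      leading        : ∀ y → undo source (parts y) ≡ 0 → 1 ≤ parts y → ancestor ch y ≡ 0 × head (labels o ch y) ≡ just k

  labelSource : ∀ {prev π} o (ch : Chain la prev π) k → o < k → (∀ y → count k (labels o ch y) ≡ 0) ⊎ LabelSource o ch k
  labelSource o stop _ _ = inj₁ (λ y → refl)
  labelSource {π = p ∷ π} o (move {κ = κ} sκ s ch) k o<k with m≤n⇒m<n∨m≡n o<k
  ... | inj₂ refl = inj₂ (record
    { source = s ; parts = ancestor ch ; parts-PartsOf = ancestor-PartsOf ch ; moveSize∈ = here refl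
    ; count≡ = count-labels-now o sκ s ch
    ; leading = starts })
    where
    starts : ∀ y → undo s (ancestor ch y) ≡ 0 → 1 ≤ ancestor ch y →
             undo s (ancestor ch y) ≡ 0 × head (labels o (move sκ s ch) y) ≡ just (suc o)
    starts y undone≡0 _ rewrite undone≡0 with ancestor ch y
    ... | suc _ = refl , refl
  ... | inj₁ o+1<k with labelSource (suc o) ch k o+1<k
  ...   | inj₁ absent = inj₁ λ y → trans (count-labels-later o sκ s ch y (<⇒≢ o+1<k)) (absent y)
  ...   | inj₂ src = inj₂ (record
    { source = source ; parts = parts ; parts-PartsOf = parts-PartsOf ; moveSize∈ = there moveSize∈
    ; count≡ = λ y → trans (count-labels-later o sκ s ch y (<⇒≢ o+1<k)) (count≡ y)
    ; leading = starts })
    where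
    open LabelSource src
    starts : ∀ y → undo source (parts y) ≡ 0 → 1 ≤ parts y →
             undo s (ancestor ch y) ≡ 0 × head (labels o (move sκ s ch) y) ≡ just k
    starts y undone≡0 1≤parts with leading y undone≡0 1≤parts
    ... | ancestor≡0 , head≡k rewrite ancestor≡0 | undo-0 s = refl , head≡k

-- The bar tableau of a chain

length-filterᵇ-map : ∀ {A B : Set} (q : B → Bool) (f : A → B) xs →
  length (filterᵇ q (map f xs)) ≡ length (filterᵇ (q ∘ f) xs)
length-filterᵇ-map q f []       = refl
length-filterᵇ-map q f (x ∷ xs) with q (f x)
... | true  = cong suc (length-filterᵇ-map q f xs)
... | false = length-filterᵇ-map q f xs

count-concat : ∀ k xss → count k (concat xss) ≡ sum (map (count k) xss)
count-concat k []         = refl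
count-concat k (xs ∷ xss) = trans (count-++ k xs (concat xss)) (cong (count k xs +_) (count-concat k xss))

elemℕ≡1≤count : ∀ k xs → elemℕ k xs ≡ (1 ≤ᵇ count k xs)
elemℕ≡1≤count k []       = refl
elemℕ≡1≤count k (x ∷ xs) with x ≟ k
... | yes refl rewrite ≡ᵇ-refl x = refl
... | no  x≢k  rewrite ≢⇒≡ᵇ≡false x≢k = elemℕ≡1≤count k xs

1≤ᵇ∸ : ∀ c d → (1 ≤ᵇ (c ∸ d)) ≡ (d <ᵇ c)
1≤ᵇ∸ c d with d <? c
... | yes d<c rewrite <⇒<ᵇ≡true d<c = ≤⇒≤ᵇ≡true (m<n⇒0<n∸m d<c)
... | no  d≮c rewrite ≤⇒<ᵇ≡false (≮⇒≥ d≮c) | m≤n⇒m∸n≡0 (≮⇒≥ d≮c) = refl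

PartsOf-strict⇒Unique : ∀ {σ} C → IsStrictPartition σ → PartsOf σ C → Unique (nonzero C)
PartsOf-strict⇒Unique C sσ h = count≤1⇒Unique (nonzero C) λ where
  zero    → subst (_≤ 1) (sym (count0-nonzero C)) z≤n
  (suc x) → subst (_≤ 1) (sym (trans (count-nonzero (suc x) C (s≤s z≤n)) (h (suc x) (s≤s z≤n))))
                  (count-strict≤1 sσ (suc x))

deduplicateᵇ-Unique : ∀ xs → Unique (deduplicateᵇ _≡ᵇ_ xs)
deduplicateᵇ-Unique []       = []
deduplicateᵇ-Unique (x ∷ xs) =
  All.tabulate (λ {v} v∈ x≡v → proj₂ (∈-filter⁻ _ {xs = deduplicateᵇ _≡ᵇ_ xs} v∈) (≡⇒≡ᵇ x v x≡v))
  ∷ Unique.filter⁺ _ (deduplicateᵇ-Unique xs)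

module BarTableau {la mu ν} (sla : IsStrictPartition la) (smu : IsStrictPartition mu)
                  (odd : ∀ {p} → p ∈ ν → p % 2 ≡ 1) (ch : Chain la mu ν) where

  B : List (List ℕ)
  B = map (barRow ch) la

  barRow-length : ∀ y → length (barRow ch y) ≡ y
  barRow-length y = begin
    length (replicate (ancestor ch y) 0 ++ labels 0 ch y)    ≡⟨ length-++ (replicate (ancestor ch y) 0) ⟩
    length (replicate (ancestor ch y) 0) + length (labels 0 ch y) ≡⟨ cong (_+ length (labels 0 ch y)) (length-replicate (ancestor ch y)) ⟩
    ancestor ch y + length (labels 0 ch y)                    ≡⟨ ancestor+length-labels 0 ch y ⟩
    y                                                         ∎
    where open ≡-Reasoning

  shapeB : map length B ≡ la
  shapeB = trans (sym (map-∘ la)) (trans (map-cong barRow-length la) (map-id la))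

  count-barRow : ∀ {k} → 1 ≤ k → ∀ y → count k (barRow ch y) ≡ count k (labels 0 ch y)
  count-barRow {k} 1≤k y =
    trans (count-++ k (replicate (ancestor ch y) 0) (labels 0 ch y))
          (cong (_+ count k (labels 0 ch y))
                (countℕ-replicate-reject (_≡ᵇ k) (ancestor ch y) 0 (≢⇒≡ᵇ≡false (≢-sym (n>0⇒n≢0 1≤k)))))

  count-B : ∀ {k} → 1 ≤ k → count k (concat B) ≡ sum (map (λ y → count k (labels 0 ch y)) la)
  count-B {k} 1≤k = trans (count-concat k B) (trans (sym (cong sum (map-∘ la))) (cong sum (map-cong (count-barRow 1≤k) la)))

  oddOccurrences : ∀ k → 1 ≤ k → 1 ≤ count k (concat B) → count k (concat B) % 2 ≡ 1
  oddOccurrences k 1≤k occurs with labelSource 0 ch k 1≤k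
  ... | inj₁ absent = ⊥-elim (1+n≰n (subst (1 ≤_) none occurs))
    where
    none : count k (concat B) ≡ 0
    none = trans (count-B 1≤k) (trans (cong sum (map-cong absent la)) (sum-zeros la))
      where
      sum-zeros : ∀ xs → sum (map (λ _ → 0) xs) ≡ 0
      sum-zeros []       = refl
      sum-zeros (_ ∷ xs) = sum-zeros xs
  ... | inj₂ src = subst (λ n → n % 2 ≡ 1) (sym total) (odd moveSize∈)
    where
    open LabelSource src
    -- the label of a move occupies exactly the cells the move added
    total : count k (concat B) ≡ moveSize
    total = begin
      count k (concat B)                                     ≡⟨ count-B 1≤k ⟩
      sum (map (λ y → count k (labels 0 ch y)) la)           ≡⟨ cong sum (map-cong count≡ la) ⟩
      sum (map (λ y → parts y ∸ undo source (parts y)) la)   ≡⟨ cong sum (map-∘ la) ⟩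
      sum (map (λ c → c ∸ undo source c) (map parts la))     ≡⟨ undo-total-drop source (map parts la) parts-PartsOf ⟩
      moveSize                                               ∎
      where open ≡-Reasoning

  rowsWith : ℕ → ℕ
  rowsWith k = length (filterᵇ (elemℕ k) B)

  RowsBeginWith : ℕ → Set
  RowsBeginWith k = ∀ y → elemℕ k (barRow ch y) ≡ true → head (barRow ch y) ≡ just k

  elemℕ-barRow : ∀ {k} → 1 ≤ k → (src : LabelSource 0 ch k) → ∀ y →
    elemℕ k (barRow ch y) ≡ (undo (LabelSource.source src) (LabelSource.parts src y) <ᵇ LabelSource.parts src y)
  elemℕ-barRow {k} 1≤k src y = begin
    elemℕ k (barRow ch y)                          ≡⟨ elemℕ≡1≤count k (barRow ch y) ⟩
    1 ≤ᵇ count k (barRow ch y)                     ≡⟨ cong (1 ≤ᵇ_) (trans (count-barRow 1≤k y) (count≡ y)) ⟩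
    1 ≤ᵇ (parts y ∸ undo source (parts y))         ≡⟨ 1≤ᵇ∸ (parts y) (undo source (parts y)) ⟩
    undo source (parts y) <ᵇ parts y               ∎
    where
    open ≡-Reasoning
    open LabelSource src

  rowsWith-lowered : ∀ {k} → 1 ≤ k → (src : LabelSource 0 ch k) →
    rowsWith k ≡ countℕ (λ c → undo (LabelSource.source src) c <ᵇ c) (map (LabelSource.parts src) la)
  rowsWith-lowered {k} 1≤k src =
    trans (length-filterᵇ-map (elemℕ k) (barRow ch) la)
          (trans (length-filterᵇ-cong _ _ la (elemℕ-barRow 1≤k src))
                 (sym (length-filterᵇ-map (λ c → undo (LabelSource.source src) c <ᵇ c) (LabelSource.parts src) la)))

  lowered : ∀ {k} → 1 ≤ k → (src : LabelSource 0 ch k) → ∀ y → elemℕ k (barRow ch y) ≡ true →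
    undo (LabelSource.source src) (LabelSource.parts src y) < LabelSource.parts src y
  lowered 1≤k src y k∈row = <ᵇ⇒< _ _ (≡true⇒T (trans (sym (elemℕ-barRow 1≤k src y)) k∈row))

  rowsWith-cases : ∀ k → 1 ≤ k → rowsWith k ≡ 0 ⊎ rowsWith k ≡ 1 ⊎ (rowsWith k ≡ 2 × RowsBeginWith k)
  rowsWith-cases k 1≤k with labelSource 0 ch k 1≤k
  ... | inj₁ absent = inj₁ (trans (length-filterᵇ-map (elemℕ k) (barRow ch) la)
                                  (cong length (filter-none (T? ∘ (elemℕ k ∘ barRow ch)) (All.universal absentRow la))))
    where
    absentRow : ∀ y → ¬ T (elemℕ k (barRow ch y))
    absentRow y t = subst T (trans (elemℕ≡1≤count k (barRow ch y)) (cong (1 ≤ᵇ_) (trans (count-barRow 1≤k y) (absent y)))) t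
  ... | inj₂ src with undo-lowers source (map parts la) parts-PartsOf
    where open LabelSource src
  ...   | inj₁ one         = inj₂ (inj₁ (trans (rowsWith-lowered 1≤k src) one))
  ...   | inj₂ (two , to0) = inj₂ (inj₂ (trans (rowsWith-lowered 1≤k src) two , begins))
    where
    open LabelSource src
    begins : RowsBeginWith k
    begins y k∈row with lt ← lowered 1≤k src y k∈row
                   with ancestor≡0 , head≡k ← leading y (to0 (parts y) lt) (<-≤-trans (s≤s z≤n) lt)
                   rewrite ancestor≡0 = head≡k

  atMostTwoRows : ∀ k → 1 ≤ k → rowsWith k ≤ 2
  atMostTwoRows k 1≤k with rowsWith-cases k 1≤k
  ... | inj₁ none             = subst (_≤ 2) (sym none) z≤n
  ... | inj₂ (inj₁ one)       = subst (_≤ 2) (sym one) (s≤s z≤n)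
  ... | inj₂ (inj₂ (two , _)) = ≤-reflexive two

  twoRowsBeginWith : ∀ k → 1 ≤ k → rowsWith k ≡ 2 → All (λ r → head r ≡ just k) (filterᵇ (elemℕ k) B)
  twoRowsBeginWith k 1≤k two with rowsWith-cases k 1≤k
  ... | inj₁ none             = ⊥-elim (0≢1+n (trans (sym none) two))
  ... | inj₂ (inj₁ one)       = ⊥-elim (0≢1+n (suc-injective (trans (sym one) two)))
  ... | inj₂ (inj₂ (_ , begins)) = All.tabulate λ r∈ → rowBegins (∈-filter⁻ (T? ∘ elemℕ k) {xs = B} r∈)
    where
    rowBegins : ∀ {r} → r ∈ B × T (elemℕ k r) → head r ≡ just k
    rowBegins (r∈B , k∈r) with y , _ , refl ← ∈-map⁻ (barRow ch) r∈B = begins y (T⇒≡true k∈r)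

  -- the entries ≤ i of row y fill the row's length in the i-th shape of the chain
  distinctStageLengths : ∀ i → Unique (nonzero (map (countℕ (_≤ᵇ i)) B))
  distinctStageLengths i with σ , sσ , partsσ ← stage-strict ch smu sla i =
    subst (Unique ∘ nonzero) (sym stageLengths) (PartsOf-strict⇒Unique (map (stage ch i) la) sσ partsσ)
    where
    stageLengths : map (countℕ (_≤ᵇ i)) B ≡ map (stage ch i) la
    stageLengths = trans (sym (map-∘ la)) (map-cong (λ y →
      trans (countℕ-++ (_≤ᵇ i) (replicate (ancestor ch y) 0) (labels 0 ch y))
            (trans (cong (_+ countℕ (_≤ᵇ i) (labels 0 ch y)) (countℕ-replicate-accept (_≤ᵇ i) (ancestor ch y) 0 refl))
                   (ancestor+labels≤ 0 ch y i z≤n))) la)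

  remainderB : nonzero (map (count 0) B) ↭ mu
  remainderB = subst (λ M → nonzero M ↭ mu) (sym zeros) (count⇒↭ _ mu same-counts)
    where
    zeros : map (count 0) B ≡ map (ancestor ch) la
    zeros = trans (sym (map-∘ la)) (map-cong (λ y →
      trans (count-++ 0 (replicate (ancestor ch y) 0) (labels 0 ch y))
            (trans (cong₂ _+_ (countℕ-replicate-accept (_≡ᵇ 0) (ancestor ch y) 0 refl) (count-labels-≤ 0 ch y z≤n))
                   (+-identityʳ _))) la)
    same-counts : ∀ k → count k (nonzero (map (ancestor ch) la)) ≡ count k mu
    same-counts zero    = trans (count0-nonzero (map (ancestor ch) la)) (sym (count0-positive (proj₁ smu)))
    same-counts (suc k) = trans (count-nonzero (suc k) (map (ancestor ch) la) (s≤s z≤n)) (ancestor-PartsOf ch (suc k) (s≤s z≤n))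

  barsB≤ : bars B ≤ length ν
  barsB≤ = Unique-bounded⇒length≤ (length ν) _ (deduplicateᵇ-Unique _)
             (All.tabulate λ v∈ →
                bounded (∈-filter⁻ (T? ∘ (1 ≤ᵇ_)) {xs = concat B} (deduplicate⁻ (λ x y → T? (x ≡ᵇ y)) v∈)))
    where
    bounded : ∀ {v} → v ∈ concat B × T (1 ≤ᵇ v) → 1 ≤ v × v ≤ length ν
    bounded {v} (v∈ , positive)
      with row , v∈row , row∈ ← ∈-concat⁻′ B v∈
      with y , _ , refl ← ∈-map⁻ (barRow ch) row∈
      with ∈-++⁻ (replicate (ancestor ch y) 0) v∈row
    ... | inj₂ v∈labels = All.lookup (labels-range 0 ch y) v∈labels
    ... | inj₁ v∈zeros  = ⊥-elim (subst (T ∘ (1 ≤ᵇ_)) (replicate-∈ v∈zeros) positive)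
      where
      replicate-∈ : ∀ {n x} → v ∈ replicate n x → v ≡ x
      replicate-∈ {suc n} (here refl) = refl
      replicate-∈ {suc n} (there v∈′) = replicate-∈ v∈′

  isSkewBarTableau : IsSkewBarTableau la mu B
  isSkewBarTableau = record
    { shape         = shapeB
    ; rowsWeak      = map⁺ (All.universal (barRow-sorted ch) la)
    ; oddOcc        = oddOccurrences
    ; twoRows       = atMostTwoRows
    ; twoRowsBegin  = twoRowsBeginWith
    ; distinctParts = distinctStageLengths
    ; remainder     = remainderB
    }

mainTheorem5 : (la mu ν : List ℕ) → IsStrictPartition la → IsStrictPartition mu →
               (∀ i j → inS mu (i , j) ≡ true → inS la (i , j) ≡ true) →
               IsPartition ν → ¬ (coeffQ la mu ν ≡ 0ℚ) →
               Σ (List (List ℕ)) (λ B → IsSkewBarTableau la mu B × bars B ≤ length ν)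
mainTheorem5 la mu ν sla smu _ (positive , _) coeff≢0
  with t , t∈ ← coeffQ≢0⇒stripTableau la mu ν coeff≢0
  = B , isSkewBarTableau , barsB≤
  where
  odd : ∀ {p} → p ∈ ν → p % 2 ≡ 1
  odd p∈ = ≡ᵇ⇒≡ _ 1 (all-lookup (λ n → n % 2 ≡ᵇ 1) (coeffQ≢0⇒allOdd la mu ν coeff≢0) p∈)
  open BarTableau sla smu odd (stripTableau⇒Chain la mu ν smu positive t∈)
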